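{- Let $s\ge3$ be an integer. Then $2^{s+1}$ is the smallest period of the sequence $\{\beta_n\bmod 2^s\}_{n\ge0}$.
   Context: $t_n$ is the number of involutions of $[n]$ (permutations with $\pi^2=1$), $t_0=1$; ${\rm ord}_2(m)$ is the largest $e$ with $2^e\mid m$; $\beta_n=t_n/2^{{\rm ord}_2(t_n)}$ is the odd part of $t_n$. A period of a sequence $(a_n)_{n\ge0}$ is a positive integer $d$ with $a_{n+d}=a_n$ for all $n\ge0$. -}

module Defs where

open import Data.Nat using (ℕ; zero; suc; _+_; _*_; _^_; _%_; _≟_)
open import Data.Nat.DivMod using (_/_)
open import Data.Nat.Properties using (m^n≢0)
open import Data.Bool using (Bool; true; false; if_then_else_)
open import Data.Fin using (Fin)
open import Data.Vec using (Vec; []; _∷_; lookup; allFin)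
open import Data.List using (List; []; _∷_; map; concatMap; length; filter)
open import Data.Fin.Properties using () renaming (_≟_ to _≟ᶠ_)
open import Relation.Nullary using (Dec; yes; no; ¬_)
open import Relation.Binary.PropositionalEquality using (_≡_)
open import Data.Vec.Relation.Unary.All using (All)
import Data.Vec.Relation.Unary.All as VAll
open import Data.Product using (_×_)
open import Relation.Nullary.Decidable using (_×-dec_)

allVecs : (k m : ℕ) → List (Vec (Fin k) m)
allVecs k zero = [] ∷ []
allVecs k (suc m) =
  concatMap (λ i → map (i ∷_) (allVecs k m)) (Data.Vec.toList (allFin k))

IsInjective : ∀ {n} → Vec (Fin n) n → Set
IsInjective {n} f =
  All (λ i → All (λ j → lookup f i ≡ lookup f j → i ≡ j) (allFin n)) (allFin n)

IsSquareId : ∀ {n} → Vec (Fin n) n → Set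
IsSquareId {n} f = All (λ i → lookup f (lookup f i) ≡ i) (allFin n)

isInjective? : ∀ {n} (f : Vec (Fin n) n) → Dec (IsInjective f)
isInjective? {n} f =
  VAll.all? (λ i → VAll.all? (λ j → dimp (lookup f i ≟ᶠ lookup f j) (i ≟ᶠ j)) (allFin n)) (allFin n)
  where
  dimp : ∀ {P Q : Set} → Dec P → Dec Q → Dec (P → Q)
  dimp _ (yes q) = yes (λ _ → q)
  dimp (yes p) (no ¬q) = no (λ h → ¬q (h p))
  dimp (no ¬p) (no _) = yes (λ p → Data.Empty.⊥-elim (¬p p))
    where import Data.Empty

isSquareId? : ∀ {n} (f : Vec (Fin n) n) → Dec (IsSquareId f)
isSquareId? {n} f = VAll.all? (λ i → lookup f (lookup f i) ≟ᶠ i) (allFin n)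

IsInvolution : ∀ {n} → Vec (Fin n) n → Set
IsInvolution f = IsInjective f × IsSquareId f

-- t n = number of involutions of [n]  (t 0 = 1: the empty permutation)
t : ℕ → ℕ
t n = length (filter (λ f → isInjective? f ×-dec isSquareId? f) (allVecs n n))

-- ord₂ m: largest e with 2^e ∣ m (for m ≥ 1); fuel-bounded recursion, fuel = m suffices
ord2-aux : ℕ → ℕ → ℕ
ord2-aux zero m = zero
ord2-aux (suc fuel) zero = zero
ord2-aux (suc fuel) (suc m) with (suc m) % 2
... | zero  = suc (ord2-aux fuel ((suc m) / 2))
... | suc _ = zero

ord2 : ℕ → ℕ
ord2 m = ord2-aux m m

β : ℕ → ℕ
β n = _/_ (t n) (2 ^ ord2 (t n)) {{m^n≢0 2 (ord2 (t n))}}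

IsPeriod : (ℕ → ℕ) → ℕ → Set
IsPeriod a d = 0 Data.Nat.< d × (∀ n → a (n + d) ≡ a n)

IsSmallestPeriod : (ℕ → ℕ) → ℕ → Set
IsSmallestPeriod a p = IsPeriod a p × (∀ d → IsPeriod a d → p Data.Nat.≤ d)

module Submission where

-- t(n) satisfies t(n + 2) = t(n + 1) + (n + 1) t(n) (classify an involution by the image of its
-- first point).  Unfolding four steps at a time gives t(4m) = 2^m a₀(m), t(4m + 1) = 2^m a₁(m),
-- t(4m + 2) = 2^(m+1) a₂(m), t(4m + 3) = 2^(m+2) a₃(m) with a₀, …, a₃ odd and satisfying a recurrence
-- whose coefficients are polynomials in 2m; hence β(4m + r) = a_r(m), and modulo 2L the shift m ↦ m + L
-- leaves the coefficients unchanged.  So as soon as a₀(L) ≡ 1 (mod 2L), the sequences a_r are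
-- L-periodic mod 2L and β mod 2L has period 4L.
--
-- For L = 2^(2+i) the congruence a₀(L) ≡ 1 holds even modulo 4L = 2^(4+i), by induction on i: in the
-- addition formula t(m + n) = Σ_k k! (m C k) (n C k) t(m - k) t(n - k) with m = n = 4L every term with
-- k ≥ 1 is divisible by 2^(2L+5+i), so t(8L) ≡ t(4L)², i.e. a₀(2L) ≡ a₀(L)² (mod 2^(5+i)).
-- Consequently a₂(L) ≡ 1 + 2L (mod 4L), so β(2 + 2^s) ≢ β(2) (mod 2^s) and 2^s is not a period
-- (s = 3 is a direct computation).  A period d < 2^(s+1) would make gcd(d, 2^(s+1)), a power of 2 at
-- most 2^s, and therefore 2^s itself a period.

open import Data.Empty using (⊥; ⊥-elim)
open import Data.Fin using (Fin; zero; suc; punchIn; punchOut)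
open import Data.Fin.Properties
  using (punchIn-punchOut; punchInᵢ≢i; punchIn-injective)
  renaming (_≟_ to _≟ᶠ_; suc-injective to suc-injectiveᶠ)
open import Data.List using (List; []; _∷_; _++_; cartesianProductWith)
import Data.List as List
open import Data.List.Membership.Propositional using (_∈_)
open import Data.List.Membership.Propositional.Properties
  using (∈-map⁺; ∈-map⁻; ∈-++⁻; ∈-++⁺ˡ; ∈-++⁺ʳ; ∈-allFin; ∈-filter⁺; ∈-filter⁻;
         ∈-cartesianProductWith⁺; ∈-cartesianProductWith⁻)
open import Data.List.Membership.Propositional.Properties.WithK using (unique∧set⇒bag)
open import Data.List.Properties using (length-++; length-map; length-tabulate)
open import Data.List.Relation.Binary.BagAndSetEquality using (∼bag⇒↭)
open import Data.List.Relation.Binary.Permutation.Propositional.Properties using (↭-length)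
open import Data.List.Relation.Unary.Any using (here)
open import Data.List.Relation.Unary.Unique.Propositional using (Unique)
import Data.List.Relation.Unary.Unique.Propositional.Properties as Unique
open import Data.Nat
open import Data.Nat.Combinatorics
open import Data.Nat.Coprimality using (Coprime; coprime-divisor)
open import Data.Nat.Divisibility
open import Data.Nat.DivMod hiding (_mod_)
open import Data.Nat.GCD
open import Data.Nat.Properties
open import Data.Nat.Tactic.RingSolver using (solve-∀)
open import Data.Product using (_×_; _,_; proj₁; proj₂; ∃)
open import Data.Sum using (_⊎_; inj₁; inj₂)
open import Data.Vec using (Vec; []; _∷_; lookup; tabulate; insertAt)
import Data.Vec as Vec
open import Data.Vec.Properties
  using (lookup-map; insertAt-lookup; insertAt-punchIn; tabulate∘lookup; tabulate-cong; lookup∘tabulate; ∷-injective)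
import Data.Vec.Relation.Unary.All.Properties as Allᵥ
open import Function using (_∘_; _⇔_; mk⇔)
open import Relation.Binary.PropositionalEquality
open import Relation.Nullary using (Dec; ¬_; yes; no)
open import Relation.Nullary.Decidable using (_×-dec_)

open import Defs

T : ℕ → ℕ
T 0 = 1
T 1 = 1
T (suc (suc n)) = T (suc n) + suc n * T n

T-suc : ∀ n → T (suc n) ≡ T n + n * T (n ∸ 1)
T-suc zero    = refl
T-suc (suc n) = refl

-- Counting involutions

lookup-injective : ∀ {A : Set} {n} {u v : Vec A n} → (∀ i → lookup u i ≡ lookup v i) → u ≡ v
lookup-injective {u = u} {v} u≗v =
  trans (sym (tabulate∘lookup u)) (trans (tabulate-cong u≗v) (tabulate∘lookup v))

toList-tabulate : ∀ {A : Set} {n} (f : Fin n → A) → Vec.toList (tabulate f) ≡ List.tabulate f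
toList-tabulate {n = zero}  f = refl
toList-tabulate {n = suc n} f = cong (f zero ∷_) (toList-tabulate (f ∘ suc))

length-cartesianProductWith : ∀ {A B C : Set} (f : A → B → C) xs ys →
  List.length (cartesianProductWith f xs ys) ≡ List.length xs * List.length ys
length-cartesianProductWith f []       ys = refl
length-cartesianProductWith f (x ∷ xs) ys =
  trans (length-++ (List.map (f x) ys)) (cong₂ _+_ (length-map (f x) ys) (length-cartesianProductWith f xs ys))

allVecs≡ : ∀ k m → allVecs k (suc m) ≡ cartesianProductWith _∷_ (List.allFin k) (allVecs k m)
allVecs≡ k m =
  trans (cong (List.concatMap (λ i → List.map (i ∷_) (allVecs k m))) (toList-tabulate {n = k} (λ i → i)))
        (go (List.allFin k))
  where
  go : ∀ is → List.concatMap (λ i → List.map (i ∷_) (allVecs k m)) is ≡ cartesianProductWith _∷_ is (allVecs k m)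
  go []       = refl
  go (i ∷ is) = cong (List.map (i ∷_) (allVecs k m) ++_) (go is)

∈-allVecs : ∀ k m (v : Vec (Fin k) m) → v ∈ allVecs k m
∈-allVecs k zero    []      = here refl
∈-allVecs k (suc m) (i ∷ v) rewrite allVecs≡ k m = ∈-cartesianProductWith⁺ _∷_ (∈-allFin i) (∈-allVecs k m v)

allVecs-unique : ∀ k m → Unique (allVecs k m)
allVecs-unique k zero    = [] ∷ []
  where
  open import Data.List.Relation.Unary.All using ([])
  open import Data.List.Relation.Unary.AllPairs using ([]; _∷_)
allVecs-unique k (suc m) rewrite allVecs≡ k m =
  Unique.cartesianProductWith⁺ _∷_ ∷-injective (Unique.allFin⁺ k) (allVecs-unique k m)

Involutive : ∀ {n} → Vec (Fin n) n → Set
Involutive σ = ∀ i → lookup σ (lookup σ i) ≡ i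

involutive⇒injective : ∀ {n} {σ : Vec (Fin n) n} → Involutive σ → ∀ {i j} → lookup σ i ≡ lookup σ j → i ≡ j
involutive⇒injective {σ = σ} inv {i} {j} σi≡σj = trans (sym (inv i)) (trans (cong (lookup σ) σi≡σj) (inv j))

involutive⇒isInvolution : ∀ {n} {σ : Vec (Fin n) n} → Involutive σ → IsInvolution σ
involutive⇒isInvolution {σ = σ} inv =
  Allᵥ.tabulate⁺ (λ i → Allᵥ.tabulate⁺ (λ j → involutive⇒injective {σ = σ} inv)) , Allᵥ.tabulate⁺ inv

isInvolution⇒involutive : ∀ {n} {σ : Vec (Fin n) n} → IsInvolution σ → Involutive σ
isInvolution⇒involutive (_ , sq) = Allᵥ.tabulate⁻ sq

isInvolution? : ∀ {n} (σ : Vec (Fin n) n) → Dec (IsInvolution σ)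
isInvolution? σ = isInjective? σ ×-dec isSquareId? σ

involutions : ∀ n → List (Vec (Fin n) n)
involutions n = List.filter isInvolution? (allVecs n n)

∈-involutions⁺ : ∀ {n} {σ : Vec (Fin n) n} → Involutive σ → σ ∈ involutions n
∈-involutions⁺ {n} {σ} inv = ∈-filter⁺ isInvolution? (∈-allVecs n n σ) (involutive⇒isInvolution {σ = σ} inv)

∈-involutions⁻ : ∀ {n} {σ : Vec (Fin n) n} → σ ∈ involutions n → Involutive σ
∈-involutions⁻ {n} {σ} σ∈ = isInvolution⇒involutive {σ = σ} (proj₂ (∈-filter⁻ isInvolution? {xs = allVecs n n} σ∈))

involutions-unique : ∀ n → Unique (involutions n)
involutions-unique n = Unique.filter⁺ isInvolution? (allVecs-unique n n)

fix₀ : ∀ {n} → Vec (Fin (suc n)) (suc n) → Vec (Fin (suc (suc n))) (suc (suc n))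
fix₀ τ = zero ∷ Vec.map suc τ

-- exchanges 0 and j + 1, and acts on the remaining points as τ does on [n], relabelled by punchIn j
swap₀ : ∀ {n} → Fin (suc n) → Vec (Fin n) n → Vec (Fin (suc (suc n))) (suc (suc n))
swap₀ j τ = suc j ∷ insertAt (Vec.map (suc ∘ punchIn j) τ) j zero

fix₀-suc : ∀ {n} (τ : Vec (Fin (suc n)) (suc n)) i → lookup (fix₀ τ) (suc i) ≡ suc (lookup τ i)
fix₀-suc τ i = lookup-map i suc τ

swap₀-j : ∀ {n} j (τ : Vec (Fin n) n) → lookup (swap₀ j τ) (suc j) ≡ zero
swap₀-j j τ = insertAt-lookup _ j zero

swap₀-punchIn : ∀ {n} j (τ : Vec (Fin n) n) k → lookup (swap₀ j τ) (suc (punchIn j k)) ≡ suc (punchIn j (lookup τ k))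
swap₀-punchIn j τ k = trans (insertAt-punchIn _ j zero k) (lookup-map k (suc ∘ punchIn j) τ)

punchIn-view : ∀ {n} (j x : Fin (suc n)) → j ≡ x ⊎ ∃ λ k → punchIn j k ≡ x
punchIn-view j x with j ≟ᶠ x
... | yes j≡x = inj₁ j≡x
... | no j≢x  = inj₂ (punchOut j≢x , punchIn-punchOut j≢x)

fix₀-involutive : ∀ {n} {τ : Vec (Fin (suc n)) (suc n)} → Involutive τ → Involutive (fix₀ τ)
fix₀-involutive {τ = τ} inv zero    = refl
fix₀-involutive {τ = τ} inv (suc i) rewrite fix₀-suc τ i | fix₀-suc τ (lookup τ i) = cong suc (inv i)

swap₀-involutive : ∀ {n} j {τ : Vec (Fin n) n} → Involutive τ → Involutive (swap₀ j τ)
swap₀-involutive j {τ} inv zero = swap₀-j j τ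
swap₀-involutive j {τ} inv (suc x) with punchIn-view j x
... | inj₁ refl       rewrite swap₀-j j τ = refl
... | inj₂ (k , refl) rewrite swap₀-punchIn j τ k | swap₀-punchIn j τ (lookup τ k) = cong (suc ∘ punchIn j) (inv k)

fix₀-injective : ∀ {n} {τ τ′ : Vec (Fin (suc n)) (suc n)} → fix₀ τ ≡ fix₀ τ′ → τ ≡ τ′
fix₀-injective {τ = τ} {τ′} eq = lookup-injective λ i →
  suc-injectiveᶠ (trans (sym (fix₀-suc τ i)) (trans (cong (λ σ → lookup σ (suc i)) eq) (fix₀-suc τ′ i)))

swap₀-injective : ∀ {n} {j j′} {τ τ′ : Vec (Fin n) n} → swap₀ j τ ≡ swap₀ j′ τ′ → j ≡ j′ × τ ≡ τ′
swap₀-injective {j = j} {τ = τ} {τ′} eq with refl ← suc-injectiveᶠ (proj₁ (∷-injective eq)) =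
  refl , lookup-injective λ k → punchIn-injective j _ _ (suc-injectiveᶠ
    (trans (sym (swap₀-punchIn j τ k)) (trans (cong (λ σ → lookup σ (suc (punchIn j k))) eq) (swap₀-punchIn j τ′ k))))

fix₀≢swap₀ : ∀ {n} {τ : Vec (Fin (suc n)) (suc n)} {j τ′} → fix₀ τ ≢ swap₀ j τ′
fix₀≢swap₀ eq with () ← proj₁ (∷-injective eq)

module Decompose {n} (σ : Vec (Fin (suc (suc n))) (suc (suc n))) (inv : Involutive σ) where

  σ-injective : ∀ {i j} → lookup σ i ≡ lookup σ j → i ≡ j
  σ-injective = involutive⇒injective {σ = σ} inv

  fixed : lookup σ zero ≡ zero → ∃ λ τ → Involutive τ × σ ≡ fix₀ τ
  fixed σ0≡0 = τ , τ-involutive , lookup-injective σ≗fix₀τ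
    where
    image : ∀ i → ∃ λ m → lookup σ (suc i) ≡ suc m
    image i with lookup σ (suc i) in eq
    ... | zero  with () ← σ-injective (trans eq (sym σ0≡0))
    ... | suc m = m , refl
    τ = tabulate (proj₁ ∘ image)
    σ-suc : ∀ i → lookup σ (suc i) ≡ suc (lookup τ i)
    σ-suc i = trans (proj₂ (image i)) (cong suc (sym (lookup∘tabulate (proj₁ ∘ image) i)))
    τ-involutive : Involutive τ
    τ-involutive i = suc-injectiveᶠ
      (trans (sym (σ-suc (lookup τ i))) (trans (cong (lookup σ) (sym (σ-suc i))) (inv (suc i))))
    σ≗fix₀τ : ∀ i → lookup σ i ≡ lookup (fix₀ τ) i
    σ≗fix₀τ zero    = σ0≡0
    σ≗fix₀τ (suc i) = trans (σ-suc i) (sym (fix₀-suc τ i))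

  swapped : ∀ j → lookup σ zero ≡ suc j → ∃ λ τ → Involutive τ × σ ≡ swap₀ j τ
  swapped j σ0≡j+1 = τ , τ-involutive , lookup-injective σ≗swap₀τ
    where
    σj+1≡0 : lookup σ (suc j) ≡ zero
    σj+1≡0 = trans (cong (lookup σ) (sym σ0≡j+1)) (inv zero)
    image : ∀ k → ∃ λ m → lookup σ (suc (punchIn j k)) ≡ suc (punchIn j m)
    image k with lookup σ (suc (punchIn j k)) in eq
    ... | zero  = ⊥-elim (punchInᵢ≢i j k (suc-injectiveᶠ (σ-injective (trans eq (sym σj+1≡0)))))
    ... | suc y with punchIn-view j y
    ...   | inj₁ refl with () ← σ-injective (trans eq (sym σ0≡j+1))
    ...   | inj₂ (m , refl) = m , refl
    τ = tabulate (proj₁ ∘ image)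
    σ-punchIn : ∀ k → lookup σ (suc (punchIn j k)) ≡ suc (punchIn j (lookup τ k))
    σ-punchIn k = trans (proj₂ (image k)) (cong (suc ∘ punchIn j) (sym (lookup∘tabulate (proj₁ ∘ image) k)))
    τ-involutive : Involutive τ
    τ-involutive k = punchIn-injective j _ _ (suc-injectiveᶠ
      (trans (sym (σ-punchIn (lookup τ k))) (trans (cong (lookup σ) (sym (σ-punchIn k))) (inv (suc (punchIn j k))))))
    σ≗swap₀τ : ∀ i → lookup σ i ≡ lookup (swap₀ j τ) i
    σ≗swap₀τ zero = σ0≡j+1
    σ≗swap₀τ (suc x) with punchIn-view j x
    ... | inj₁ refl       = trans σj+1≡0 (sym (swap₀-j j τ))
    ... | inj₂ (k , refl) = trans (σ-punchIn k) (sym (swap₀-punchIn j τ k))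

  decompose : (∃ λ τ → Involutive τ × σ ≡ fix₀ τ) ⊎ (∃ λ j → ∃ λ τ → Involutive τ × σ ≡ swap₀ j τ)
  decompose with lookup σ zero in eq
  ... | zero  = inj₁ (fixed eq)
  ... | suc j = inj₂ (j , swapped j eq)

module _ (n : ℕ) where

  byFirstPoint : List (Vec (Fin (suc (suc n))) (suc (suc n)))
  byFirstPoint =
    List.map fix₀ (involutions (suc n)) ++ cartesianProductWith swap₀ (List.allFin (suc n)) (involutions n)

  byFirstPoint-unique : Unique byFirstPoint
  byFirstPoint-unique = Unique.++⁺
    (Unique.map⁺ fix₀-injective (involutions-unique (suc n)))
    (Unique.cartesianProductWith⁺ swap₀ swap₀-injective (Unique.allFin⁺ (suc n)) (involutions-unique n))
    disjoint
    where
    disjoint : ∀ {σ} → σ ∈ List.map fix₀ (involutions (suc n)) ×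
                       σ ∈ cartesianProductWith swap₀ (List.allFin (suc n)) (involutions n) → ⊥
    disjoint (σ∈₁ , σ∈₂)
      with _ , _ , refl ← ∈-map⁻ fix₀ σ∈₁
      with _ , _ , _ , _ , eq ← ∈-cartesianProductWith⁻ swap₀ (List.allFin (suc n)) (involutions n) σ∈₂
      = fix₀≢swap₀ eq

  ∈-byFirstPoint⇔ : ∀ {σ} → σ ∈ involutions (suc (suc n)) ⇔ σ ∈ byFirstPoint
  ∈-byFirstPoint⇔ {σ} = mk⇔ to from
    where
    to : σ ∈ involutions (suc (suc n)) → σ ∈ byFirstPoint
    to σ∈ with Decompose.decompose σ (∈-involutions⁻ σ∈)
    ... | inj₁ (τ , inv , refl)     = ∈-++⁺ˡ (∈-map⁺ fix₀ (∈-involutions⁺ inv))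
    ... | inj₂ (j , τ , inv , refl) =
      ∈-++⁺ʳ (List.map fix₀ (involutions (suc n))) (∈-cartesianProductWith⁺ swap₀ (∈-allFin j) (∈-involutions⁺ inv))
    from : σ ∈ byFirstPoint → σ ∈ involutions (suc (suc n))
    from σ∈ with ∈-++⁻ (List.map fix₀ (involutions (suc n))) σ∈
    ... | inj₁ σ∈₁ with τ , τ∈ , refl ← ∈-map⁻ fix₀ σ∈₁ =
      ∈-involutions⁺ (fix₀-involutive (∈-involutions⁻ τ∈))
    ... | inj₂ σ∈₂
      with j , τ , _ , τ∈ , refl ← ∈-cartesianProductWith⁻ swap₀ (List.allFin (suc n)) (involutions n) σ∈₂ =
      ∈-involutions⁺ (swap₀-involutive j (∈-involutions⁻ τ∈))

  t-suc-suc : t (suc (suc n)) ≡ t (suc n) + suc n * t n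
  t-suc-suc = begin
    List.length (involutions (suc (suc n)))
      ≡⟨ ↭-length (∼bag⇒↭ (unique∧set⇒bag (involutions-unique (suc (suc n))) byFirstPoint-unique ∈-byFirstPoint⇔)) ⟩
    List.length byFirstPoint
      ≡⟨ length-++ (List.map fix₀ (involutions (suc n))) ⟩
    _ ≡⟨ cong₂ _+_ (length-map fix₀ (involutions (suc n)))
                   (trans (length-cartesianProductWith swap₀ (List.allFin (suc n)) (involutions n))
                          (cong (_* t n) (length-tabulate {n = suc n} (λ i → i)))) ⟩
    t (suc n) + suc n * t n ∎
    where open ≡-Reasoning

t≡T : ∀ n → t n ≡ T n
t≡T 0             = refl
t≡T 1             = refl
t≡T (suc (suc n)) = trans (t-suc-suc n) (cong₂ (λ a b → a + suc n * b) (t≡T (suc n)) (t≡T n))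

-- Binomial coefficients and the addition formula for T

[1+k]*[1+n]C[1+k]≡[1+n]*nCk : ∀ n k → suc k * (suc n C suc k) ≡ suc n * (n C k)
[1+k]*[1+n]C[1+k]≡[1+n]*nCk zero    zero    = refl
[1+k]*[1+n]C[1+k]≡[1+n]*nCk zero    (suc k) =
  trans (cong (suc (suc k) *_) (k>n⇒nCk≡0 {1} {suc (suc k)} (s≤s (s≤s z≤n)))) (*-zeroʳ (suc (suc k)))
[1+k]*[1+n]C[1+k]≡[1+n]*nCk (suc n) zero    =
  trans (+-identityʳ _) (trans (nC1≡n (suc (suc n))) (sym (*-identityʳ (suc (suc n)))))
[1+k]*[1+n]C[1+k]≡[1+n]*nCk (suc n) (suc k) = begin
  suc (suc k) * (suc (suc n) C suc (suc k))
    ≡⟨ cong (suc (suc k) *_) (nCk+nC[k+1]≡[n+1]C[k+1] (suc n) (suc k)) ⟨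
  suc (suc k) * (suc n C suc k + suc n C suc (suc k))
    ≡⟨ *-distribˡ-+ (suc (suc k)) (suc n C suc k) _ ⟩
  suc (suc k) * (suc n C suc k) + suc (suc k) * (suc n C suc (suc k))
    ≡⟨ cong₂ (λ x y → suc n C suc k + x + y) ([1+k]*[1+n]C[1+k]≡[1+n]*nCk n k) ([1+k]*[1+n]C[1+k]≡[1+n]*nCk n (suc k)) ⟩
  suc n C suc k + suc n * (n C k) + suc n * (n C suc k)
    ≡⟨ cong (λ x → x + suc n * (n C k) + suc n * (n C suc k)) (nCk+nC[k+1]≡[n+1]C[k+1] n k) ⟨
  (n C k + n C suc k) + suc n * (n C k) + suc n * (n C suc k)
    ≡⟨ regroup (n C k) (n C suc k) n ⟩
  suc (suc n) * (n C k + n C suc k)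
    ≡⟨ cong (suc (suc n) *_) (nCk+nC[k+1]≡[n+1]C[k+1] n k) ⟩
  suc (suc n) * (suc n C suc k) ∎
  where
  open ≡-Reasoning
  regroup : ∀ a b n → (a + b) + suc n * a + suc n * b ≡ suc (suc n) * (a + b)
  regroup = solve-∀

[1+n∸k]*[1+n]Ck≡[1+n]*nCk : ∀ n k → (suc n ∸ k) * (suc n C k) ≡ suc n * (n C k)
[1+n∸k]*[1+n]Ck≡[1+n]*nCk n zero    = refl
[1+n∸k]*[1+n]Ck≡[1+n]*nCk n (suc k) with k ≤? n
... | no k≰n = begin
  (n ∸ k) * (suc n C suc k) ≡⟨ cong ((n ∸ k) *_) (k>n⇒nCk≡0 (s≤s n<k)) ⟩
  (n ∸ k) * 0               ≡⟨ *-zeroʳ (n ∸ k) ⟩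
  0                         ≡⟨ *-zeroʳ (suc n) ⟨
  suc n * 0                 ≡⟨ cong (suc n *_) (k>n⇒nCk≡0 (m<n⇒m<1+n n<k)) ⟨
  suc n * (n C suc k)       ∎
  where open ≡-Reasoning; n<k = ≰⇒> k≰n
... | yes k≤n = +-cancelˡ-≡ (suc n * (n C k)) _ _ (begin
  suc n * (n C k) + (n ∸ k) * X
    ≡⟨ cong (_+ (n ∸ k) * X) ([1+k]*[1+n]C[1+k]≡[1+n]*nCk n k) ⟨
  suc k * X + (n ∸ k) * X
    ≡⟨ *-distribʳ-+ X (suc k) (n ∸ k) ⟨
  (suc k + (n ∸ k)) * X
    ≡⟨ cong (λ m → suc m * X) (m+[n∸m]≡n k≤n) ⟩
  suc n * X
    ≡⟨ cong (suc n *_) (nCk+nC[k+1]≡[n+1]C[k+1] n k) ⟨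
  suc n * (n C k + n C suc k)
    ≡⟨ *-distribˡ-+ (suc n) (n C k) (n C suc k) ⟩
  suc n * (n C k) + suc n * (n C suc k) ∎)
  where open ≡-Reasoning; X = suc n C suc k

CT : ℕ → ℕ → ℕ
CT m k = (m C k) * T (m ∸ k)

C*T[1+m∸k] : ∀ m k → (m C k) * T (suc m ∸ k) ≡ CT m k + m * CT (m ∸ 1) k
C*T[1+m∸k] zero    zero    = refl
C*T[1+m∸k] zero    (suc k) rewrite k>n⇒nCk≡0 {0} {suc k} z<s = refl
C*T[1+m∸k] (suc m) k with k ≤? suc m
... | no k≰m rewrite k>n⇒nCk≡0 (≰⇒> k≰m) | k>n⇒nCk≡0 (<-trans (n<1+n m) (≰⇒> k≰m)) | *-zeroʳ m = refl
... | yes k≤m = begin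
  B * T (suc (suc m) ∸ k)          ≡⟨ cong (λ x → B * T x) (+-∸-assoc 1 k≤m) ⟩
  B * T (suc j)                    ≡⟨ cong (B *_) (T-suc j) ⟩
  B * (T j + j * T (j ∸ 1))        ≡⟨ distrib B (T j) j (T (j ∸ 1)) ⟩
  B * T j + (j * B) * T (j ∸ 1)    ≡⟨ cong (λ x → B * T j + x * T (j ∸ 1)) ([1+n∸k]*[1+n]Ck≡[1+n]*nCk m k) ⟩
  B * T j + (suc m * (m C k)) * T (j ∸ 1)
    ≡⟨ cong (λ x → B * T j + (suc m * (m C k)) * T x) (trans (∸-+-assoc (suc m) k 1) (cong (suc m ∸_) (+-comm k 1))) ⟩
  B * T j + (suc m * (m C k)) * T (m ∸ k)
    ≡⟨ cong (B * T j +_) (*-assoc (suc m) (m C k) (T (m ∸ k))) ⟩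
  CT (suc m) k + suc m * CT m k      ∎
  where
  open ≡-Reasoning
  B = suc m C k
  j = suc m ∸ k
  distrib : ∀ b t j u → b * (t + j * u) ≡ b * t + (j * b) * u
  distrib = solve-∀

CT-suc-zero : ∀ m → CT (suc m) 0 ≡ CT m 0 + m * CT (m ∸ 1) 0
CT-suc-zero m = C*T[1+m∸k] m 0

CT-suc-suc : ∀ m k → CT (suc m) (suc k) ≡ CT m (suc k) + m * CT (m ∸ 1) (suc k) + CT m k
CT-suc-suc m k = begin
  (suc m C suc k) * T (m ∸ k)          ≡⟨ cong (_* T (m ∸ k)) (nCk+nC[k+1]≡[n+1]C[k+1] m k) ⟨
  (m C k + m C suc k) * T (m ∸ k)      ≡⟨ *-distribʳ-+ (T (m ∸ k)) (m C k) (m C suc k) ⟩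
  CT m k + (m C suc k) * T (suc m ∸ suc k) ≡⟨ cong (CT m k +_) (C*T[1+m∸k] m (suc k)) ⟩
  CT m k + (CT m (suc k) + m * CT (m ∸ 1) (suc k))
    ≡⟨ +-comm (CT m k) _ ⟩
  CT m (suc k) + m * CT (m ∸ 1) (suc k) + CT m k ∎
  where open ≡-Reasoning

[1+k]*CT[n][1+k]≡n*CT[n∸1]k : ∀ n k → suc k * CT n (suc k) ≡ n * CT (n ∸ 1) k
[1+k]*CT[n][1+k]≡n*CT[n∸1]k zero    k = *-zeroʳ (suc k)
[1+k]*CT[n][1+k]≡n*CT[n∸1]k (suc n) k = begin
  suc k * ((suc n C suc k) * T (n ∸ k))   ≡⟨ *-assoc (suc k) (suc n C suc k) (T (n ∸ k)) ⟨
  suc k * (suc n C suc k) * T (n ∸ k)   ≡⟨ cong (_* T (n ∸ k)) ([1+k]*[1+n]C[1+k]≡[1+n]*nCk n k) ⟩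
  suc n * (n C k) * T (n ∸ k)           ≡⟨ *-assoc (suc n) (n C k) (T (n ∸ k)) ⟩
  suc n * CT n k                         ∎
  where open ≡-Reasoning

sumTo : (ℕ → ℕ) → ℕ → ℕ
sumTo f zero    = 0
sumTo f (suc n) = sumTo f n + f n

sumTo-cong : ∀ {f g} n → (∀ k → k < n → f k ≡ g k) → sumTo f n ≡ sumTo g n
sumTo-cong zero    f≗g = refl
sumTo-cong (suc n) f≗g =
  cong₂ _+_ (sumTo-cong n (λ k k<n → f≗g k (m<n⇒m<1+n k<n))) (f≗g n (n<1+n n))

sumTo-+ : ∀ f g n → sumTo (λ k → f k + g k) n ≡ sumTo f n + sumTo g n
sumTo-+ f g zero    = refl
sumTo-+ f g (suc n) rewrite sumTo-+ f g n = interchange (sumTo f n) (sumTo g n) (f n) (g n)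
  where
  interchange : ∀ a b c d → a + b + (c + d) ≡ a + c + (b + d)
  interchange = solve-∀

sumTo-* : ∀ c f n → sumTo (λ k → c * f k) n ≡ c * sumTo f n
sumTo-* c f zero    = sym (*-zeroʳ c)
sumTo-* c f (suc n) rewrite sumTo-* c f n = sym (*-distribˡ-+ c (sumTo f n) (f n))

sumTo-head : ∀ f n → sumTo f (suc n) ≡ f 0 + sumTo (λ k → f (suc k)) n
sumTo-head f zero    = +-comm 0 (f 0)
sumTo-head f (suc n) rewrite sumTo-head f n = +-assoc (f 0) _ _

sumTo-∣ : ∀ {d} f n → (∀ k → k < n → d ∣ f k) → d ∣ sumTo f n
sumTo-∣ f zero    d∣f = _ ∣0
sumTo-∣ f (suc n) d∣f =
  ∣m∣n⇒∣m+n (sumTo-∣ f n (λ k k<n → d∣f k (m<n⇒m<1+n k<n))) (d∣f n (n<1+n n))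

-- the number of involutions of [m + n] pairing exactly k of the first m points with some of the last n
cross : ℕ → ℕ → ℕ → ℕ
cross m n k = k ! * CT m k * CT n k

cross-suc-zero : ∀ m n → cross (suc m) n 0 ≡ cross m n 0 + m * cross (m ∸ 1) n 0
cross-suc-zero m n rewrite CT-suc-zero m = distrib (CT m 0) m (CT (m ∸ 1) 0) (CT n 0)
  where
  distrib : ∀ a m b c → 1 * (a + m * b) * c ≡ 1 * a * c + m * (1 * b * c)
  distrib = solve-∀

cross-suc-suc : ∀ m n k →
  cross (suc m) n (suc k) ≡ cross m n (suc k) + m * cross (m ∸ 1) n (suc k) + n * cross m (n ∸ 1) k
cross-suc-suc m n k = begin
  suc k ! * CT (suc m) (suc k) * CT n (suc k)
    ≡⟨ cong (λ x → suc k ! * x * CT n (suc k)) (CT-suc-suc m k) ⟩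
  suc k ! * (CT m (suc k) + m * CT (m ∸ 1) (suc k) + CT m k) * CT n (suc k)
    ≡⟨ distrib (suc k) (k !) (CT m (suc k)) m (CT (m ∸ 1) (suc k)) (CT m k) (CT n (suc k)) ⟩
  cross m n (suc k) + m * cross (m ∸ 1) n (suc k) + k ! * CT m k * (suc k * CT n (suc k))
    ≡⟨ cong (λ x → cross m n (suc k) + m * cross (m ∸ 1) n (suc k) + k ! * CT m k * x)
            ([1+k]*CT[n][1+k]≡n*CT[n∸1]k n k) ⟩
  cross m n (suc k) + m * cross (m ∸ 1) n (suc k) + k ! * CT m k * (n * CT (n ∸ 1) k)
    ≡⟨ cong (cross m n (suc k) + m * cross (m ∸ 1) n (suc k) +_) (swap (k !) (CT m k) n (CT (n ∸ 1) k)) ⟩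
  cross m n (suc k) + m * cross (m ∸ 1) n (suc k) + n * cross m (n ∸ 1) k ∎
  where
  open ≡-Reasoning
  distrib : ∀ s f a m b c d →
    (s * f) * (a + m * b + c) * d ≡ (s * f) * a * d + m * ((s * f) * b * d) + f * c * (s * d)
  distrib = solve-∀
  swap : ∀ f a n b → f * a * (n * b) ≡ n * (f * a * b)
  swap = solve-∀

crossSum-suc : ∀ m n B → sumTo (cross (suc m) n) (suc B) ≡
  sumTo (cross m n) (suc B) + m * sumTo (cross (m ∸ 1) n) (suc B) + n * sumTo (cross m (n ∸ 1)) B
crossSum-suc m n B = begin
  sumTo (cross (suc m) n) (suc B)
    ≡⟨ sumTo-head (cross (suc m) n) B ⟩
  cross (suc m) n 0 + sumTo (λ k → cross (suc m) n (suc k)) B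
    ≡⟨ cong₂ _+_ (cross-suc-zero m n) (sumTo-cong B (λ k _ → cross-suc-suc m n k)) ⟩
  (c₀ + m * c₀′) + sumTo (λ k → cross m n (suc k) + m * cross (m ∸ 1) n (suc k) + n * cross m (n ∸ 1) k) B
    ≡⟨ cong ((c₀ + m * c₀′) +_) (begin
         _ ≡⟨ sumTo-+ _ _ B ⟩
         _ ≡⟨ cong₂ _+_ (sumTo-+ _ _ B) (sumTo-* n _ B) ⟩
         _ ≡⟨ cong (λ x → s + x + n * sumTo (cross m (n ∸ 1)) B) (sumTo-* m _ B) ⟩
         _ ∎) ⟩
  (c₀ + m * c₀′) + (s + m * s′ + n * sumTo (cross m (n ∸ 1)) B)
    ≡⟨ regroup c₀ m c₀′ s s′ (n * sumTo (cross m (n ∸ 1)) B) ⟩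
  (c₀ + s) + m * (c₀′ + s′) + n * sumTo (cross m (n ∸ 1)) B
    ≡⟨ cong₂ (λ x y → x + m * y + n * sumTo (cross m (n ∸ 1)) B)
             (sumTo-head (cross m n) B) (sumTo-head (cross (m ∸ 1) n) B) ⟨
  sumTo (cross m n) (suc B) + m * sumTo (cross (m ∸ 1) n) (suc B) + n * sumTo (cross m (n ∸ 1)) B ∎
  where
  open ≡-Reasoning
  c₀ = cross m n 0
  c₀′ = cross (m ∸ 1) n 0
  s = sumTo (λ k → cross m n (suc k)) B
  s′ = sumTo (λ k → cross (m ∸ 1) n (suc k)) B
  regroup : ∀ a m b c d e → (a + m * b) + (c + m * d + e) ≡ (a + c) + m * (b + d) + e
  regroup = solve-∀

crossSum-stable : ∀ m n B → m < B → sumTo (cross m n) B ≡ sumTo (cross m n) (suc m)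
crossSum-stable m n B m<B with m≤n⇒∃[o]m+o≡n m<B
... | o , refl = go o
  where
  cross-vanishes : ∀ k → m < k → cross m n k ≡ 0
  cross-vanishes k m<k rewrite k>n⇒nCk≡0 m<k | *-zeroʳ (k !) = refl
  go : ∀ o → sumTo (cross m n) (suc m + o) ≡ sumTo (cross m n) (suc m)
  go zero    rewrite +-identityʳ m = refl
  go (suc o) rewrite +-suc m o | cross-vanishes (suc (m + o)) (s≤s (m≤m+n m o))
                   | +-identityʳ (sumTo (cross m n) (suc m + o)) = go o

crossSum : ℕ → ℕ → ℕ
crossSum m n = sumTo (cross m n) (suc m)

crossSum-rec : ∀ m n → crossSum (suc m) n ≡ crossSum m n + m * crossSum (m ∸ 1) n + n * crossSum m (n ∸ 1)
crossSum-rec m n = begin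
  sumTo (cross (suc m) n) (suc (suc m))
    ≡⟨ crossSum-suc m n (suc m) ⟩
  sumTo (cross m n) (suc (suc m)) + m * sumTo (cross (m ∸ 1) n) (suc (suc m)) + n * crossSum m (n ∸ 1)
    ≡⟨ cong₂ (λ x y → x + m * y + n * crossSum m (n ∸ 1))
             (crossSum-stable m n _ (m<n⇒m<1+n (n<1+n m)))
             (crossSum-stable (m ∸ 1) n _ (s≤s (≤-trans (m∸n≤m m 1) (n≤1+n m)))) ⟩
  crossSum m n + m * crossSum (m ∸ 1) n + n * crossSum m (n ∸ 1) ∎
  where open ≡-Reasoning

T-suc-suc-+ : ∀ m n → T (suc (suc m) + n) ≡ T (suc m + n) + suc m * T (m + n) + n * T (suc m + (n ∸ 1))
T-suc-suc-+ m zero    rewrite +-identityʳ m = sym (+-identityʳ _)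
T-suc-suc-+ m (suc n) rewrite +-suc m n = split (T (suc (suc (m + n)))) m n (T (suc (m + n)))
  where
  split : ∀ a m n b → a + suc (suc (m + n)) * b ≡ a + suc m * b + suc n * b
  split = solve-∀

T-+ : ∀ m n → T (m + n) ≡ crossSum m n
T-+ zero          n = sym (trans (+-identityʳ _) (+-identityʳ (T n)))
T-+ (suc zero)    n = begin
  T (suc n)                         ≡⟨ T-suc n ⟩
  T n + n * T (n ∸ 1)               ≡⟨ cong₂ (λ x y → x + n * y) (T-+ 0 n) (T-+ 0 (n ∸ 1)) ⟩
  crossSum 0 n + n * crossSum 0 (n ∸ 1)
    ≡⟨ cong (_+ n * crossSum 0 (n ∸ 1)) (+-identityʳ (crossSum 0 n)) ⟨
  crossSum 0 n + 0 + n * crossSum 0 (n ∸ 1) ≡⟨ crossSum-rec 0 n ⟨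
  crossSum 1 n                      ∎
  where open ≡-Reasoning
T-+ (suc (suc m)) n = begin
  T (suc (suc m) + n)
    ≡⟨ T-suc-suc-+ m n ⟩
  T (suc m + n) + suc m * T (m + n) + n * T (suc m + (n ∸ 1))
    ≡⟨ cong₂ (λ x y → x + suc m * y + n * T (suc m + (n ∸ 1))) (T-+ (suc m) n) (T-+ m n) ⟩
  crossSum (suc m) n + suc m * crossSum m n + n * T (suc m + (n ∸ 1))
    ≡⟨ cong (λ x → crossSum (suc m) n + suc m * crossSum m n + n * x) (T-+ (suc m) (n ∸ 1)) ⟩
  crossSum (suc m) n + suc m * crossSum m n + n * crossSum (suc m) (n ∸ 1)
    ≡⟨ crossSum-rec (suc m) n ⟨
  crossSum (suc (suc m)) n ∎
  where open ≡-Reasoning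

-- T along the residue classes mod 4

-- the even summands are written 2 * _ (and a₁'s odd one 1 * _) to fit the shape of odd*odd+even
a₀ a₂ a₃ : ℕ → ℕ
a₀ zero    = 1
a₀ (suc m) = (3 + m * 4) * a₂ m + 2 * a₃ m
a₂ zero    = 1
a₂ (suc m) = (3 + m * 2) * a₀ (suc m) + 2 * ((1 + m) * 2 * a₃ m)
a₃ zero    = 1
a₃ (suc m) = (3 + m * 2) * a₀ (suc m) + 2 * ((1 + m) * (7 + m * 4) * a₃ m)

a₁ : ℕ → ℕ
a₁ zero    = 1
a₁ (suc m) = 1 * a₀ (suc m) + 2 * ((1 + m) * 4 * a₃ m)

module _ (m : ℕ) (e₂ : T (2 + m * 4) ≡ 2 ^ suc m * a₂ m) (e₃ : T (3 + m * 4) ≡ 2 ^ suc (suc m) * a₃ m) where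

  private
    x = 2 ^ m

  T-4[m+1] : T (suc m * 4) ≡ 2 ^ suc m * a₀ (suc m)
  T-4[m+1] = trans (cong₂ (λ u v → u + (3 + m * 4) * v) e₃ e₂) (step x m (a₂ m) (a₃ m))
    where
    step : ∀ x m p q → 2 * (2 * x) * q + (3 + m * 4) * (2 * x * p) ≡ 2 * x * ((3 + m * 4) * p + 2 * q)
    step = solve-∀

  T-4[m+1]+1 : T (1 + suc m * 4) ≡ 2 ^ suc m * a₁ (suc m)
  T-4[m+1]+1 = trans (cong₂ (λ u v → u + (4 + m * 4) * v) T-4[m+1] e₃) (step x m (a₀ (suc m)) (a₃ m))
    where
    step : ∀ x m a q → 2 * x * a + (4 + m * 4) * (2 * (2 * x) * q) ≡ 2 * x * (1 * a + 2 * ((1 + m) * 4 * q))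
    step = solve-∀

  T-4[m+1]+2 : T (2 + suc m * 4) ≡ 2 ^ suc (suc m) * a₂ (suc m)
  T-4[m+1]+2 = trans (cong₂ (λ u v → u + (5 + m * 4) * v) T-4[m+1]+1 T-4[m+1]) (step x m (a₀ (suc m)) (a₃ m))
    where
    step : ∀ x m a q → 2 * x * (1 * a + 2 * ((1 + m) * 4 * q)) + (5 + m * 4) * (2 * x * a)
                     ≡ 2 * (2 * x) * ((3 + m * 2) * a + 2 * ((1 + m) * 2 * q))
    step = solve-∀

  T-4[m+1]+3 : T (3 + suc m * 4) ≡ 2 ^ suc (suc (suc m)) * a₃ (suc m)
  T-4[m+1]+3 = trans (cong₂ (λ u v → u + (6 + m * 4) * v) T-4[m+1]+2 T-4[m+1]+1) (step x m (a₀ (suc m)) (a₃ m))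
    where
    step : ∀ x m a q → 2 * (2 * x) * ((3 + m * 2) * a + 2 * ((1 + m) * 2 * q))
                       + (6 + m * 4) * (2 * x * (1 * a + 2 * ((1 + m) * 4 * q)))
                     ≡ 2 * (2 * (2 * x)) * ((3 + m * 2) * a + 2 * ((1 + m) * (7 + m * 4) * q))
    step = solve-∀

T-4m+2∧T-4m+3 : ∀ m → T (2 + m * 4) ≡ 2 ^ suc m * a₂ m × T (3 + m * 4) ≡ 2 ^ suc (suc m) * a₃ m
T-4m+2∧T-4m+3 zero    = refl , refl
T-4m+2∧T-4m+3 (suc m) with e₂ , e₃ ← T-4m+2∧T-4m+3 m = T-4[m+1]+2 m e₂ e₃ , T-4[m+1]+3 m e₂ e₃

T-4m+2 : ∀ m → T (2 + m * 4) ≡ 2 ^ suc m * a₂ m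
T-4m+2 m = proj₁ (T-4m+2∧T-4m+3 m)

T-4m+3 : ∀ m → T (3 + m * 4) ≡ 2 ^ suc (suc m) * a₃ m
T-4m+3 m = proj₂ (T-4m+2∧T-4m+3 m)

T-4m : ∀ m → T (m * 4) ≡ 2 ^ m * a₀ m
T-4m zero    = refl
T-4m (suc m) = T-4[m+1] m (T-4m+2 m) (T-4m+3 m)

T-4m+1 : ∀ m → T (1 + m * 4) ≡ 2 ^ m * a₁ m
T-4m+1 zero    = refl
T-4m+1 (suc m) = T-4[m+1]+1 m (T-4m+2 m) (T-4m+3 m)

Odd : ℕ → Set
Odd x = ∃ λ h → x ≡ 1 + 2 * h

odd*odd+even : ∀ {x y} → Odd x → Odd y → ∀ z → Odd (x * y + 2 * z)
odd*odd+even (h , refl) (k , refl) z = h + k + 2 * h * k + z , expand h k z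
  where
  expand : ∀ h k z → (1 + 2 * h) * (1 + 2 * k) + 2 * z ≡ 1 + 2 * (h + k + 2 * h * k + z)
  expand = solve-∀

odd-3+m*2 : ∀ m → Odd (3 + m * 2)
odd-3+m*2 m = suc m , regroup m
  where
  regroup : ∀ m → 3 + m * 2 ≡ 1 + 2 * suc m
  regroup = solve-∀

odd-3+m*4 : ∀ m → Odd (3 + m * 4)
odd-3+m*4 m = suc (m * 2) , regroup m
  where
  regroup : ∀ m → 3 + m * 4 ≡ 1 + 2 * suc (m * 2)
  regroup = solve-∀

odd-a₀ : ∀ m → Odd (a₀ m)
odd-a₂∧odd-a₃ : ∀ m → Odd (a₂ m) × Odd (a₃ m)

odd-a₀ zero    = 0 , refl
odd-a₀ (suc m) = odd*odd+even (odd-3+m*4 m) (proj₁ (odd-a₂∧odd-a₃ m)) (a₃ m)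

odd-a₂∧odd-a₃ zero    = (0 , refl) , (0 , refl)
odd-a₂∧odd-a₃ (suc m) =
    odd*odd+even (odd-3+m*2 m) (odd-a₀ (suc m)) ((1 + m) * 2 * a₃ m)
  , odd*odd+even (odd-3+m*2 m) (odd-a₀ (suc m)) ((1 + m) * (7 + m * 4) * a₃ m)

odd-a₁ : ∀ m → Odd (a₁ m)
odd-a₁ zero    = 0 , refl
odd-a₁ (suc m) = odd*odd+even (0 , refl) (odd-a₀ (suc m)) ((1 + m) * 4 * a₃ m)

-- The odd part

ord2-aux-odd : ∀ fuel {x} → suc x % 2 ≡ 1 → ord2-aux (suc fuel) (suc x) ≡ 0
ord2-aux-odd fuel {x} eq with suc x % 2
... | suc _ = refl

ord2-aux-even : ∀ fuel {x} → suc x % 2 ≡ 0 → ord2-aux (suc fuel) (suc x) ≡ suc (ord2-aux fuel (suc x / 2))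
ord2-aux-even fuel {x} eq with suc x % 2
... | zero = refl

ord2-aux-2* : ∀ fuel x .{{_ : NonZero x}} → ord2-aux (suc fuel) (2 * x) ≡ suc (ord2-aux fuel x)
ord2-aux-2* fuel x@(suc _) = begin
  ord2-aux (suc fuel) (2 * x)           ≡⟨ ord2-aux-even fuel (trans (cong (_% 2) (*-comm 2 x)) (m*n%n≡0 x 2)) ⟩
  suc (ord2-aux fuel (2 * x / 2))       ≡⟨ cong (λ y → suc (ord2-aux fuel y)) (trans (cong (_/ 2) (*-comm 2 x)) (m*n/n≡m x 2)) ⟩
  suc (ord2-aux fuel x)                 ∎
  where open ≡-Reasoning

odd-nonZero : ∀ {o} → Odd o → NonZero o
odd-nonZero (h , refl) = _

ord2-aux-2^e*odd : ∀ e {o} fuel → Odd o → e < fuel → ord2-aux fuel (2 ^ e * o) ≡ e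
ord2-aux-2^e*odd zero    (suc fuel) (h , refl) _ = ord2-aux-odd fuel (begin
  suc (2 * h + 0) % 2   ≡⟨ cong (λ y → suc y % 2) (trans (+-identityʳ (2 * h)) (*-comm 2 h)) ⟩
  (1 + h * 2) % 2       ≡⟨ [m+kn]%n≡m%n 1 h 2 ⟩
  1                     ∎)
  where open ≡-Reasoning
ord2-aux-2^e*odd (suc e) {o} (suc fuel) odd (s≤s e<fuel) = begin
  ord2-aux (suc fuel) (2 * 2 ^ e * o)   ≡⟨ cong (ord2-aux (suc fuel)) (*-assoc 2 (2 ^ e) o) ⟩
  ord2-aux (suc fuel) (2 * (2 ^ e * o)) ≡⟨ ord2-aux-2* fuel (2 ^ e * o) {{m*n≢0 (2 ^ e) o {{m^n≢0 2 e}} {{odd-nonZero odd}}}} ⟩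
  suc (ord2-aux fuel (2 ^ e * o))       ≡⟨ cong suc (ord2-aux-2^e*odd e fuel odd e<fuel) ⟩
  suc e                                 ∎
  where open ≡-Reasoning

n<2^n : ∀ n → n < 2 ^ n
n<2^n zero    = z<s
n<2^n (suc n) = +-mono-≤-< (m^n>0 2 n) (subst (n <_) (sym (+-identityʳ (2 ^ n))) (n<2^n n))

ord2-2^e*odd : ∀ e {o} → Odd o → ord2 (2 ^ e * o) ≡ e
ord2-2^e*odd e odd = ord2-aux-2^e*odd e _ odd
  (≤-trans (n<2^n e) (m≤m*n (2 ^ e) _ {{odd-nonZero odd}}))

β-2^e*odd : ∀ n e {o} → t n ≡ 2 ^ e * o → Odd o → β n ≡ o
β-2^e*odd n e {o} tn≡2^e*o odd = begin
  _/_ (t n) (2 ^ ord2 (t n)) {{m^n≢0 2 (ord2 (t n))}}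
    ≡⟨ /-congʳ {{m^n≢0 2 (ord2 (t n))}} {{m^n≢0 2 e}} (cong (2 ^_) (trans (cong ord2 tn≡2^e*o) (ord2-2^e*odd e odd))) ⟩
  _/_ (t n) (2 ^ e) {{m^n≢0 2 e}}
    ≡⟨ cong (λ x → _/_ x (2 ^ e) {{m^n≢0 2 e}}) (trans tn≡2^e*o (*-comm (2 ^ e) o)) ⟩
  _/_ (o * 2 ^ e) (2 ^ e) {{m^n≢0 2 e}}
    ≡⟨ m*n/n≡m o (2 ^ e) {{m^n≢0 2 e}} ⟩
  o ∎
  where open ≡-Reasoning

-- Powers of 2 dividing T, factorials and binomial coefficients

even⊎odd : ∀ n → (∃ λ h → n ≡ 2 * h) ⊎ Odd n
even⊎odd zero    = inj₁ (0 , refl)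
even⊎odd (suc n) with even⊎odd n
... | inj₁ (h , refl) = inj₂ (h , refl)
... | inj₂ (h , refl) = inj₁ (suc h , cong suc (sym (+-suc h (h + 0))))

2∤odd : ∀ {n} → Odd n → ¬ 2 ∣ n
2∤odd (h , refl) 2∣n with () ← ∣1⇒≡1 (∣m+n∣m⇒∣n (subst (2 ∣_) (+-comm 1 (2 * h)) 2∣n) (m∣m*n h))

∣2^k⇒≡2^e : ∀ k {g} → g ∣ 2 ^ k → ∃ λ e → g ≡ 2 ^ e
∣2^k⇒≡2^e zero    g∣1 = 0 , ∣1⇒≡1 g∣1
∣2^k⇒≡2^e (suc k) {g} g∣2^[1+k] with even⊎odd g
... | inj₁ (h , refl) with e , refl ← ∣2^k⇒≡2^e k {h} (*-cancelˡ-∣ 2 g∣2^[1+k]) = suc e , refl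
... | inj₂ (h , refl) =
  ∣2^k⇒≡2^e k (∣m+n∣m⇒∣n (subst (g ∣_) (expand h (2 ^ k)) (∣n⇒∣m*n (1 + h) g∣2^[1+k])) (m∣m*n (2 ^ k)))
  where
  expand : ∀ h x → (1 + h) * (2 * x) ≡ (1 + 2 * h) * x + x
  expand = solve-∀

coprime-2^-odd : ∀ a {o} → Odd o → Coprime (2 ^ a) o
coprime-2^-odd a odd (d∣2^a , d∣o) with ∣2^k⇒≡2^e a d∣2^a
... | zero  , refl = refl
... | suc e , refl = ⊥-elim (2∤odd odd (∣-trans (m∣m*n (2 ^ e)) d∣o))

2^a∣odd*x⇒2^a∣x : ∀ a {o x} → Odd o → 2 ^ a ∣ o * x → 2 ^ a ∣ x
2^a∣odd*x⇒2^a∣x a odd = coprime-divisor (coprime-2^-odd a odd)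

*-pres-^∣ : ∀ {m} a b {x y} → m ^ a ∣ x → m ^ b ∣ y → m ^ (a + b) ∣ x * y
*-pres-^∣ {m} a b p q = subst (_∣ _) (sym (^-distribˡ-+-* m a b)) (*-pres-∣ p q)

^∣-weaken : ∀ {m} a b {x} → m ^ (a + b) ∣ x → m ^ a ∣ x
^∣-weaken {m} a b = ∣-trans (subst (m ^ a ∣_) (sym (^-distribˡ-+-* m a b)) (m∣m*n (m ^ b)))

2^m∣T[4m] : ∀ m → 2 ^ m ∣ T (m * 4)
2^m∣T[4m] m = subst (2 ^ m ∣_) (sym (T-4m m)) (m∣m*n (a₀ m))

2^m∣T[4m+1] : ∀ m → 2 ^ m ∣ T (1 + m * 4)
2^m∣T[4m+1] m = subst (2 ^ m ∣_) (sym (T-4m+1 m)) (m∣m*n (a₁ m))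

2^[1+m]∣T[4m+2] : ∀ m → 2 ^ (1 + m) ∣ T (2 + m * 4)
2^[1+m]∣T[4m+2] m = subst (2 ^ (1 + m) ∣_) (sym (T-4m+2 m)) (m∣m*n (a₂ m))

2^[2+m]∣T[4m+3] : ∀ m → 2 ^ (2 + m) ∣ T (3 + m * 4)
2^[2+m]∣T[4m+3] m = subst (2 ^ (2 + m) ∣_) (sym (T-4m+3 m)) (m∣m*n (a₃ m))

2^[3e]∣[4e]! : ∀ e → 2 ^ (e * 3) ∣ (e * 4) !
2^[3e]∣[4e]! zero    = ∣-refl
2^[3e]∣[4e]! (suc e) = subst (2 ^ (3 + e * 3) ∣_) (sym (regroup e ((e * 4) !)))
  (*-pres-^∣ 3 (e * 3) (divides c (factor e)) (2^[3e]∣[4e]! e))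
  where
  c = (1 + e) * (1 + e * 2) * (3 + e * 4) * (1 + e * 4)
  regroup : ∀ e f → (4 + e * 4) * ((3 + e * 4) * ((2 + e * 4) * ((1 + e * 4) * f)))
                  ≡ 8 * ((1 + e) * (1 + e * 2) * (3 + e * 4) * (1 + e * 4)) * f
  regroup = solve-∀
  factor : ∀ e → 8 * ((1 + e) * (1 + e * 2) * (3 + e * 4) * (1 + e * 4)) ≡ (1 + e) * (1 + e * 2) * (3 + e * 4) * (1 + e * 4) * 2 ^ 3
  factor = solve-∀

2^[3e]∣[4e+1]! : ∀ e → 2 ^ (e * 3) ∣ (1 + e * 4) !
2^[3e]∣[4e+1]! e = ∣n⇒∣m*n (1 + e * 4) (2^[3e]∣[4e]! e)

2^[3e+1]∣[4e+2]! : ∀ e → 2 ^ (1 + e * 3) ∣ (2 + e * 4) !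
2^[3e+1]∣[4e+2]! e = subst (2 ^ (1 + e * 3) ∣_) (sym (regroup e ((e * 4) !)))
  (*-pres-^∣ 1 (e * 3) (divides ((1 + e * 2) * (1 + e * 4)) (factor e)) (2^[3e]∣[4e]! e))
  where
  regroup : ∀ e f → (2 + e * 4) * ((1 + e * 4) * f) ≡ (2 * ((1 + e * 2) * (1 + e * 4))) * f
  regroup = solve-∀
  factor : ∀ e → 2 * ((1 + e * 2) * (1 + e * 4)) ≡ (1 + e * 2) * (1 + e * 4) * 2 ^ 1
  factor = solve-∀

2^[3e+1]∣[4e+3]! : ∀ e → 2 ^ (1 + e * 3) ∣ (3 + e * 4) !
2^[3e+1]∣[4e+3]! e = ∣n⇒∣m*n (3 + e * 4) (2^[3e+1]∣[4e+2]! e)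

-- from (k + 1) (N C (k + 1)) = N ((N - 1) C k)
2^e∣NC[1+k] : ∀ e a {o N k} .{{_ : NonZero N}} → Odd o → suc k ≡ 2 ^ a * o → 2 ^ (a + e) ∣ N → 2 ^ e ∣ N C suc k
2^e∣NC[1+k] e a {o} {N@(suc n)} {k} odd k+1≡ 2^[a+e]∣N =
  *-cancelˡ-∣ (2 ^ a) {{m^n≢0 2 a}} (subst (_∣ 2 ^ a * (N C suc k)) (^-distribˡ-+-* 2 a e)
    (2^a∣odd*x⇒2^a∣x (a + e) odd (subst (2 ^ (a + e) ∣_) N*C≡ (∣m⇒∣m*n (n C k) 2^[a+e]∣N))))
  where
  N*C≡ : N * (n C k) ≡ o * (2 ^ a * (N C suc k))
  N*C≡ = begin
    N * (n C k)              ≡⟨ [1+k]*[1+n]C[1+k]≡[1+n]*nCk n k ⟨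
    suc k * (N C suc k)      ≡⟨ cong (_* (N C suc k)) k+1≡ ⟩
    2 ^ a * o * (N C suc k)  ≡⟨ swap (2 ^ a) o (N C suc k) ⟩
    o * (2 ^ a * (N C suc k)) ∎
    where
    open ≡-Reasoning
    swap : ∀ x o c → x * o * c ≡ o * (x * c)
    swap = solve-∀

cross-suc : ∀ n k → cross n n (suc k) ≡ k ! * n * CT (n ∸ 1) k * CT n (suc k)
cross-suc n k = begin
  suc k * k ! * CT n (suc k) * CT n (suc k)     ≡⟨ regroup (suc k) (k !) (CT n (suc k)) ⟩
  k ! * (suc k * CT n (suc k)) * CT n (suc k)   ≡⟨ cong (λ x → k ! * x * CT n (suc k)) ([1+k]*CT[n][1+k]≡n*CT[n∸1]k n k) ⟩
  k ! * (n * CT (n ∸ 1) k) * CT n (suc k)       ≡⟨ cong (_* CT n (suc k)) (*-assoc (k !) n (CT (n ∸ 1) k)) ⟨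
  k ! * n * CT (n ∸ 1) k * CT n (suc k)         ∎
  where
  open ≡-Reasoning
  regroup : ∀ s f m → s * f * m * m ≡ f * (s * m) * m
  regroup = solve-∀

-- T(2N) ≡ T(N)² for N = 2^(4+i)

module Doubling (i : ℕ) where

  L N E : ℕ
  L = 2 ^ (2 + i)
  N = 2 ^ (4 + i)
  E = L + L + (5 + i)

  instance
    N≢0 : NonZero N
    N≢0 = m^n≢0 2 (4 + i)

  N≡L*4 : N ≡ L * 4
  N≡L*4 = regroup (2 ^ i)
    where
    regroup : ∀ x → 2 * (2 * (2 * (2 * x))) ≡ 2 * (2 * x) * 4
    regroup = solve-∀

  cross-div : ∀ k F G → 2 ^ F ∣ k ! → 2 ^ G ∣ T (N ∸ suc k) → 2 ^ (F + (4 + i) + G + G) ∣ cross N N (suc k)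
  cross-div k F G 2^F∣k! 2^G∣T = subst (2 ^ (F + (4 + i) + G + G) ∣_) (sym (cross-suc N k))
    (*-pres-^∣ (F + (4 + i) + G) G
      (*-pres-^∣ (F + (4 + i)) G (*-pres-^∣ F (4 + i) 2^F∣k! ∣-refl)
        (∣n⇒∣m*n ((N ∸ 1) C k) (subst (λ n → 2 ^ G ∣ T n) (sym (∸-+-assoc N 1 k)) 2^G∣T)))
      (∣n⇒∣m*n (N C suc k) 2^G∣T))

  cross-div-small : ∀ k F B G → 2 ^ F ∣ suc k ! → 2 ^ B ∣ N C suc k → 2 ^ G ∣ T (N ∸ suc k) →
                    2 ^ (F + (B + G) + (B + G)) ∣ cross N N (suc k)
  cross-div-small k F B G 2^F∣[1+k]! 2^B∣C 2^G∣T =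
    *-pres-^∣ (F + (B + G)) (B + G) (*-pres-^∣ F (B + G) 2^F∣[1+k]! 2^[B+G]∣CT) 2^[B+G]∣CT
    where 2^[B+G]∣CT = *-pres-^∣ B G 2^B∣C 2^G∣T

  -- k = r + 4d and N - (k + 1) = (3 - r) + 4u with d + u + 1 = L
  module _ (d u : ℕ) (L≡ : L ≡ suc (d + u)) where

    T[N∸[1+k]] : ∀ {G} k c → suc (d + u) * 4 ≡ suc k + c → 2 ^ G ∣ T c → 2 ^ G ∣ T (N ∸ suc k)
    T[N∸[1+k]] {G} k c eq = subst (λ n → 2 ^ G ∣ T n)
      (sym (trans (cong (_∸ suc k) (trans N≡L*4 (trans (cong (_* 4) L≡) eq))) (m+n∸m≡n (suc k) c)))

    2^[E+s]∣⇒2^E∣ : ∀ {x} a s → a ≡ suc (d + u) + suc (d + u) + (5 + i) + s → 2 ^ a ∣ x → 2 ^ E ∣ x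
    2^[E+s]∣⇒2^E∣ a s eq =
      ^∣-weaken E s ∘ subst (λ e → 2 ^ e ∣ _) (trans eq (cong (λ l → l + l + (5 + i) + s) (sym L≡)))

  cross-div-E₀ : ∀ d u → L ≡ suc (d + u) → 2 ^ E ∣ cross N N (suc (d * 4))
  cross-div-E₀ d u L≡ = 2^[E+s]∣⇒2^E∣ d u L≡ _ (suc d) (exponent d u i)
    (cross-div (d * 4) (d * 3) (2 + u) (2^[3e]∣[4e]! d)
      (T[N∸[1+k]] d u L≡ {2 + u} (d * 4) (3 + u * 4) (split d u) (2^[2+m]∣T[4m+3] u)))
    where
    split : ∀ d u → suc (d + u) * 4 ≡ suc (d * 4) + (3 + u * 4)
    split = solve-∀
    exponent : ∀ d u i → d * 3 + (4 + i) + (2 + u) + (2 + u) ≡ suc (d + u) + suc (d + u) + (5 + i) + suc d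
    exponent = solve-∀

  cross-div-E₁ : ∀ d u → L ≡ suc (d + u) → 2 ^ E ∣ cross N N (suc (1 + d * 4))
  cross-div-E₁ zero u L≡ = 2^[E+s]∣⇒2^E∣ 0 u L≡ _ (2 + i) (exponent u i)
    (cross-div-small 1 1 (3 + i) (1 + u) (divides 1 refl) (2^e∣NC[1+k] (3 + i) 1 (0 , refl) refl ∣-refl)
      (T[N∸[1+k]] 0 u L≡ {1 + u} 1 (2 + u * 4) (split u) (2^[1+m]∣T[4m+2] u)))
    where
    split : ∀ u → suc (0 + u) * 4 ≡ 2 + (2 + u * 4)
    split = solve-∀
    exponent : ∀ u i → 1 + ((3 + i) + (1 + u)) + ((3 + i) + (1 + u)) ≡ suc (0 + u) + suc (0 + u) + (5 + i) + (2 + i)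
    exponent = solve-∀
  cross-div-E₁ (suc d) u L≡ = 2^[E+s]∣⇒2^E∣ (suc d) u L≡ _ d (exponent d u i)
    (cross-div (1 + suc d * 4) (suc d * 3) (1 + u) (2^[3e]∣[4e+1]! (suc d))
      (T[N∸[1+k]] (suc d) u L≡ {1 + u} (1 + suc d * 4) (2 + u * 4) (split d u) (2^[1+m]∣T[4m+2] u)))
    where
    split : ∀ d u → suc (suc d + u) * 4 ≡ suc (1 + suc d * 4) + (2 + u * 4)
    split = solve-∀
    exponent : ∀ d u i → suc d * 3 + (4 + i) + (1 + u) + (1 + u) ≡ suc (suc d + u) + suc (suc d + u) + (5 + i) + d
    exponent = solve-∀

  cross-div-E₂ : ∀ d u → L ≡ suc (d + u) → 2 ^ E ∣ cross N N (suc (2 + d * 4))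
  cross-div-E₂ zero u L≡ = 2^[E+s]∣⇒2^E∣ 0 u L≡ _ (2 + i) (exponent u i)
    (cross-div-small 2 1 (4 + i) u (divides 3 refl) (2^e∣NC[1+k] (4 + i) 0 (1 , refl) refl ∣-refl)
      (T[N∸[1+k]] 0 u L≡ {u} 2 (1 + u * 4) (split u) (2^m∣T[4m+1] u)))
    where
    split : ∀ u → suc (0 + u) * 4 ≡ 3 + (1 + u * 4)
    split = solve-∀
    exponent : ∀ u i → 1 + ((4 + i) + u) + ((4 + i) + u) ≡ suc (0 + u) + suc (0 + u) + (5 + i) + (2 + i)
    exponent = solve-∀
  cross-div-E₂ (suc zero) u L≡ = 2^[E+s]∣⇒2^E∣ 1 u L≡ _ (3 + i) (exponent u i)
    (cross-div-small 6 4 (4 + i) u (divides 315 refl) (2^e∣NC[1+k] (4 + i) 0 (3 , refl) refl ∣-refl)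
      (T[N∸[1+k]] 1 u L≡ {u} 6 (1 + u * 4) (split u) (2^m∣T[4m+1] u)))
    where
    split : ∀ u → suc (1 + u) * 4 ≡ 7 + (1 + u * 4)
    split = solve-∀
    exponent : ∀ u i → 4 + ((4 + i) + u) + ((4 + i) + u) ≡ suc (1 + u) + suc (1 + u) + (5 + i) + (3 + i)
    exponent = solve-∀
  cross-div-E₂ (suc (suc d)) u L≡ = 2^[E+s]∣⇒2^E∣ (suc (suc d)) u L≡ _ d (exponent d u i)
    (cross-div (2 + suc (suc d) * 4) (1 + suc (suc d) * 3) u (2^[3e+1]∣[4e+2]! (suc (suc d)))
      (T[N∸[1+k]] (suc (suc d)) u L≡ {u} (2 + suc (suc d) * 4) (1 + u * 4) (split d u) (2^m∣T[4m+1] u)))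
    where
    split : ∀ d u → suc (suc (suc d) + u) * 4 ≡ suc (2 + suc (suc d) * 4) + (1 + u * 4)
    split = solve-∀
    exponent : ∀ d u i → 1 + suc (suc d) * 3 + (4 + i) + u + u ≡ suc (suc (suc d) + u) + suc (suc (suc d) + u) + (5 + i) + d
    exponent = solve-∀

  cross-div-E₃ : ∀ d u → L ≡ suc (d + u) → 2 ^ E ∣ cross N N (suc (3 + d * 4))
  cross-div-E₃ zero u L≡ = 2^[E+s]∣⇒2^E∣ 0 u L≡ _ i (exponent u i)
    (cross-div-small 3 3 (2 + i) u (divides 3 refl) (2^e∣NC[1+k] (2 + i) 2 (0 , refl) refl ∣-refl)
      (T[N∸[1+k]] 0 u L≡ {u} 3 (u * 4) (split u) (2^m∣T[4m] u)))
    where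
    split : ∀ u → suc (0 + u) * 4 ≡ 4 + u * 4
    split = solve-∀
    exponent : ∀ u i → 3 + ((2 + i) + u) + ((2 + i) + u) ≡ suc (0 + u) + suc (0 + u) + (5 + i) + i
    exponent = solve-∀
  cross-div-E₃ (suc zero) u L≡ = 2^[E+s]∣⇒2^E∣ 1 u L≡ _ i (exponent u i)
    (cross-div-small 7 7 (1 + i) u (divides 315 refl) (2^e∣NC[1+k] (1 + i) 3 (0 , refl) refl ∣-refl)
      (T[N∸[1+k]] 1 u L≡ {u} 7 (u * 4) (split u) (2^m∣T[4m] u)))
    where
    split : ∀ u → suc (1 + u) * 4 ≡ 8 + u * 4
    split = solve-∀
    exponent : ∀ u i → 7 + ((1 + i) + u) + ((1 + i) + u) ≡ suc (1 + u) + suc (1 + u) + (5 + i) + i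
    exponent = solve-∀
  cross-div-E₃ (suc (suc d)) u L≡ = 2^[E+s]∣⇒2^E∣ (suc (suc d)) u L≡ _ d (exponent d u i)
    (cross-div (3 + suc (suc d) * 4) (1 + suc (suc d) * 3) u (2^[3e+1]∣[4e+3]! (suc (suc d)))
      (T[N∸[1+k]] (suc (suc d)) u L≡ {u} (3 + suc (suc d) * 4) (u * 4) (split d u) (2^m∣T[4m] u)))
    where
    split : ∀ d u → suc (suc (suc d) + u) * 4 ≡ suc (3 + suc (suc d) * 4) + u * 4
    split = solve-∀
    exponent : ∀ d u i → 1 + suc (suc d) * 3 + (4 + i) + u + u ≡ suc (suc (suc d) + u) + suc (suc (suc d) + u) + (5 + i) + d
    exponent = solve-∀

  cross-div-E : ∀ k → k < N → 2 ^ E ∣ cross N N (suc k)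
  cross-div-E k k<N with u , L≡ ← m≤n⇒∃[o]m+o≡n (m<n*o⇒m/o<n {k} {L} {4} (subst (k <_) N≡L*4 k<N)) =
    subst (λ k → 2 ^ E ∣ cross N N (suc k)) (sym (m≡m%n+[m/n]*n k 4)) (by-residue (k % 4) (m%n<n k 4))
    where
    by-residue : ∀ r → r < 4 → 2 ^ E ∣ cross N N (suc (r + k / 4 * 4))
    by-residue 0 _ = cross-div-E₀ (k / 4) u (sym L≡)
    by-residue 1 _ = cross-div-E₁ (k / 4) u (sym L≡)
    by-residue 2 _ = cross-div-E₂ (k / 4) u (sym L≡)
    by-residue 3 _ = cross-div-E₃ (k / 4) u (sym L≡)
    by-residue (suc (suc (suc (suc _)))) (s≤s (s≤s (s≤s (s≤s ()))))

  T[N+N] : ∃ λ Z → T (N + N) ≡ T N * T N + Z * 2 ^ E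
  T[N+N] with divides Z eq ← sumTo-∣ (λ k → cross N N (suc k)) N cross-div-E = Z , (begin
    T (N + N)                                    ≡⟨ T-+ N N ⟩
    sumTo (cross N N) (suc N)                    ≡⟨ sumTo-head (cross N N) N ⟩
    cross N N 0 + sumTo (λ k → cross N N (suc k)) N ≡⟨ cong₂ _+_ (square (T N)) eq ⟩
    T N * T N + Z * 2 ^ E                        ∎)
    where
    open ≡-Reasoning
    square : ∀ a → 1 * (1 * a) * (1 * a) ≡ a * a
    square = solve-∀

a₀[2^[2+i]]≡1+2^[4+i]*Y : ∀ i → ∃ λ Y → a₀ (2 ^ (2 + i)) ≡ 1 + 2 ^ (4 + i) * Y
a₀[2^[2+i]]≡1+2^[4+i]*Y zero    = 180495 , refl
a₀[2^[2+i]]≡1+2^[4+i]*Y (suc i) with Y , eY ← a₀[2^[2+i]]≡1+2^[4+i]*Y i | Z , eZ ← Doubling.T[N+N] i =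
  Y + 2 ^ (3 + i) * Y * Y + Z , (begin
    a₀ (2 * L)                            ≡⟨ *-cancelˡ-≡ (a₀ (2 * L)) _ (X * X) {{X²≢0}} X²*a₀[2L] ⟩
    a₀ L * a₀ L + Z * 2 ^ (5 + i)         ≡⟨ cong (λ a → a * a + Z * 2 ^ (5 + i)) eY ⟩
    (1 + 2 ^ (4 + i) * Y) * (1 + 2 ^ (4 + i) * Y) + Z * 2 ^ (5 + i)
                                          ≡⟨ expand (2 ^ i) Y Z ⟩
    1 + 2 ^ (4 + suc i) * (Y + 2 ^ (3 + i) * Y * Y + Z) ∎)
  where
  open ≡-Reasoning
  L = 2 ^ (2 + i)
  X = 2 ^ L
  X²≢0 = m*n≢0 X X {{m^n≢0 2 L}} {{m^n≢0 2 L}}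
  X²*a₀[2L] : X * X * a₀ (2 * L) ≡ X * X * (a₀ L * a₀ L + Z * 2 ^ (5 + i))
  X²*a₀[2L] = begin
    X * X * a₀ (2 * L)                  ≡⟨ cong (_* a₀ (2 * L)) (^-distribˡ-+-* 2 L L) ⟨
    2 ^ (L + L) * a₀ (2 * L)            ≡⟨ cong (λ e → 2 ^ (L + e) * a₀ (2 * L)) (+-identityʳ L) ⟨
    2 ^ (2 * L) * a₀ (2 * L)            ≡⟨ T-4m (2 * L) ⟨
    T (2 * L * 4)                       ≡⟨ cong T (double (2 ^ i)) ⟩
    T (2 ^ (4 + i) + 2 ^ (4 + i))       ≡⟨ eZ ⟩
    T (2 ^ (4 + i)) * T (2 ^ (4 + i)) + Z * 2 ^ (L + L + (5 + i))
                                        ≡⟨ cong₂ (λ t e → t * t + Z * e) (trans (cong T (Doubling.N≡L*4 i)) (T-4m L))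
                                                 (trans (^-distribˡ-+-* 2 (L + L) (5 + i)) (cong (_* 2 ^ (5 + i)) (^-distribˡ-+-* 2 L L))) ⟩
    X * a₀ L * (X * a₀ L) + Z * (X * X * 2 ^ (5 + i))
                                        ≡⟨ factor X (a₀ L) Z (2 ^ (5 + i)) ⟩
    X * X * (a₀ L * a₀ L + Z * 2 ^ (5 + i)) ∎
    where
    double : ∀ x → 2 * (2 * (2 * x)) * 4 ≡ 2 * (2 * (2 * (2 * x))) + 2 * (2 * (2 * (2 * x)))
    double = solve-∀
    factor : ∀ x a z p → x * a * (x * a) + z * (x * x * p) ≡ x * x * (a * a + z * p)
    factor = solve-∀
  expand : ∀ w y z → (1 + 2 * (2 * (2 * (2 * w))) * y) * (1 + 2 * (2 * (2 * (2 * w))) * y) + z * (2 * (2 * (2 * (2 * (2 * w)))))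
                   ≡ 1 + 2 * (2 * (2 * (2 * (2 * w)))) * (y + 2 * (2 * (2 * w)) * y * y + z)
  expand = solve-∀

-- Periodicity of β modulo 2L

infix 4 _≡_mod_
record _≡_mod_ (x y M : ℕ) .{{_ : NonZero M}} : Set where
  constructor mod-intro
  field mod-elim : x % M ≡ y % M
open _≡_mod_

module _ {M : ℕ} .{{_ : NonZero M}} where

  +-cong-mod : ∀ {x y u v} → x ≡ y mod M → u ≡ v mod M → x + u ≡ y + v mod M
  +-cong-mod {x} {y} {u} {v} (mod-intro x≡y) (mod-intro u≡v) = mod-intro
    (trans (%-distribˡ-+ x u M) (trans (cong₂ (λ a b → (a + b) % M) x≡y u≡v) (sym (%-distribˡ-+ y v M))))

  *-cong-mod : ∀ {x y u v} → x ≡ y mod M → u ≡ v mod M → x * u ≡ y * v mod M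
  *-cong-mod {x} {y} {u} {v} (mod-intro x≡y) (mod-intro u≡v) = mod-intro
    (trans (%-distribˡ-* x u M) (trans (cong₂ (λ a b → (a * b) % M) x≡y u≡v) (sym (%-distribˡ-* y v M))))

  x+k*M≡x-mod : ∀ x k → x + k * M ≡ x mod M
  x+k*M≡x-mod x k = mod-intro ([m+kn]%n≡m%n x k M)

  refl-mod : ∀ x → x ≡ x mod M
  refl-mod x = mod-intro refl

  trans-mod : ∀ {x y z} → x ≡ y mod M → y ≡ z mod M → x ≡ z mod M
  trans-mod (mod-intro x≡y) (mod-intro y≡z) = mod-intro (trans x≡y y≡z)

  ≡⇒≡-mod : ∀ {x y} → x ≡ y → x ≡ y mod M
  ≡⇒≡-mod {x} refl = refl-mod x

β-4m : ∀ m → β (m * 4) ≡ a₀ m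
β-4m m = β-2^e*odd (m * 4) m (trans (t≡T (m * 4)) (T-4m m)) (odd-a₀ m)

β-4m+1 : ∀ m → β (1 + m * 4) ≡ a₁ m
β-4m+1 m = β-2^e*odd (1 + m * 4) m (trans (t≡T (1 + m * 4)) (T-4m+1 m)) (odd-a₁ m)

β-4m+2 : ∀ m → β (2 + m * 4) ≡ a₂ m
β-4m+2 m = β-2^e*odd (2 + m * 4) (suc m) (trans (t≡T (2 + m * 4)) (T-4m+2 m)) (proj₁ (odd-a₂∧odd-a₃ m))

β-4m+3 : ∀ m → β (3 + m * 4) ≡ a₃ m
β-4m+3 m = β-2^e*odd (3 + m * 4) (suc (suc m)) (trans (t≡T (3 + m * 4)) (T-4m+3 m)) (proj₂ (odd-a₂∧odd-a₃ m))

step₀ step₁ step₂ step₃ : ℕ → ℕ → ℕ → ℕ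
step₀ z p q = (3 + z * 2) * p + 2 * q
step₁ z a q = a + (2 + z) * 4 * q
step₂ z a q = (3 + z) * a + (2 + z) * 2 * q
step₃ z a q = (3 + z) * a + (2 + z) * (7 + z * 2) * q

-- the recurrences of a₀, …, a₃ as polynomials in z = 2m, which the shift m ↦ m + L changes by 2L
a₀-step : ∀ m → a₀ (suc m) ≡ step₀ (m * 2) (a₂ m) (a₃ m)
a₀-step m = poly m (a₂ m) (a₃ m)
  where
  poly : ∀ m p q → (3 + m * 4) * p + 2 * q ≡ (3 + m * 2 * 2) * p + 2 * q
  poly = solve-∀

a₁-step : ∀ m → a₁ (suc m) ≡ step₁ (m * 2) (a₀ (suc m)) (a₃ m)
a₁-step m = poly m (a₀ (suc m)) (a₃ m)
  where
  poly : ∀ m a q → 1 * a + 2 * ((1 + m) * 4 * q) ≡ a + (2 + m * 2) * 4 * q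
  poly = solve-∀

a₂-step : ∀ m → a₂ (suc m) ≡ step₂ (m * 2) (a₀ (suc m)) (a₃ m)
a₂-step m = poly m (a₀ (suc m)) (a₃ m)
  where
  poly : ∀ m a q → (3 + m * 2) * a + 2 * ((1 + m) * 2 * q) ≡ (3 + m * 2) * a + (2 + m * 2) * 2 * q
  poly = solve-∀

a₃-step : ∀ m → a₃ (suc m) ≡ step₃ (m * 2) (a₀ (suc m)) (a₃ m)
a₃-step m = poly m (a₀ (suc m)) (a₃ m)
  where
  poly : ∀ m a q → (3 + m * 2) * a + 2 * ((1 + m) * (7 + m * 4) * q) ≡ (3 + m * 2) * a + (2 + m * 2) * (7 + m * 2 * 2) * q
  poly = solve-∀

module _ {M : ℕ} .{{_ : NonZero M}} {z z′ p p′ q q′ : ℕ}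
         (z≡ : z ≡ z′ mod M) (p≡ : p ≡ p′ mod M) (q≡ : q ≡ q′ mod M) where

  step₀-cong : step₀ z p q ≡ step₀ z′ p′ q′ mod M
  step₀-cong = +-cong-mod (*-cong-mod (+-cong-mod (refl-mod 3) (*-cong-mod z≡ (refl-mod 2))) p≡)
                          (*-cong-mod (refl-mod 2) q≡)

  step₁-cong : step₁ z p q ≡ step₁ z′ p′ q′ mod M
  step₁-cong = +-cong-mod p≡ (*-cong-mod (*-cong-mod (+-cong-mod (refl-mod 2) z≡) (refl-mod 4)) q≡)

  step₂-cong : step₂ z p q ≡ step₂ z′ p′ q′ mod M
  step₂-cong = +-cong-mod (*-cong-mod (+-cong-mod (refl-mod 3) z≡) p≡)
                          (*-cong-mod (*-cong-mod (+-cong-mod (refl-mod 2) z≡) (refl-mod 2)) q≡)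

  step₃-cong : step₃ z p q ≡ step₃ z′ p′ q′ mod M
  step₃-cong = +-cong-mod (*-cong-mod (+-cong-mod (refl-mod 3) z≡) p≡)
                          (*-cong-mod (*-cong-mod (+-cong-mod (refl-mod 2) z≡) (+-cong-mod (refl-mod 7) (*-cong-mod z≡ (refl-mod 2))))
                                      q≡)

module Periodicity (ℓ : ℕ) (a₀L≡1 : a₀ (suc ℓ) ≡ 1 mod (2 * suc ℓ)) where

  private
    L 2L : ℕ
    L = suc ℓ
    2L = 2 * L

  z-shift : ∀ m → (m + L) * 2 ≡ m * 2 mod 2L
  z-shift m = trans-mod (≡⇒≡-mod (shift m L)) (x+k*M≡x-mod (m * 2) 1)
    where
    shift : ∀ m l → (m + l) * 2 ≡ m * 2 + 1 * (2 * l)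
    shift = solve-∀

  -- at m = L the recurrences reduce, modulo 2L, to a₀ L
  a₁L≡1 : a₁ L ≡ 1 mod 2L
  a₁L≡1 = trans-mod (≡⇒≡-mod (unfold ℓ (a₀ L) (a₃ ℓ)))
                    (trans-mod (x+k*M≡x-mod (a₀ L) (4 * a₃ ℓ)) a₀L≡1)
    where
    unfold : ∀ l a q → 1 * a + 2 * ((1 + l) * 4 * q) ≡ a + 4 * q * (2 * suc l)
    unfold = solve-∀

  a₂L≡1 : a₂ L ≡ 1 mod 2L
  a₂L≡1 = trans-mod (≡⇒≡-mod (unfold ℓ (a₀ L) (a₃ ℓ)))
                    (trans-mod (x+k*M≡x-mod (a₀ L) (a₀ L + 2 * a₃ ℓ)) a₀L≡1)
    where
    unfold : ∀ l a q → (3 + l * 2) * a + 2 * ((1 + l) * 2 * q) ≡ a + (a + 2 * q) * (2 * suc l)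
    unfold = solve-∀

  a₃L≡1 : a₃ L ≡ 1 mod 2L
  a₃L≡1 = trans-mod (≡⇒≡-mod (unfold ℓ (a₀ L) (a₃ ℓ)))
                    (trans-mod (x+k*M≡x-mod (a₀ L) (a₀ L + (7 + ℓ * 4) * a₃ ℓ)) a₀L≡1)
    where
    unfold : ∀ l a q → (3 + l * 2) * a + 2 * ((1 + l) * (7 + l * 4) * q) ≡ a + (a + (7 + l * 4) * q) * (2 * suc l)
    unfold = solve-∀

  private
    stepwise : ∀ {x y s s′} → x ≡ s → s ≡ s′ mod 2L → y ≡ s′ → x ≡ y mod 2L
    stepwise refl s≡s′ refl = s≡s′

  a₀-periodic-suc : ∀ m → a₂ (m + L) ≡ a₂ m mod 2L → a₃ (m + L) ≡ a₃ m mod 2L →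
                    a₀ (suc m + L) ≡ a₀ (suc m) mod 2L
  a₀-periodic-suc m p₂ p₃ = stepwise (a₀-step (m + L)) (step₀-cong (z-shift m) p₂ p₃) (a₀-step m)

  a₂a₃-periodic : ∀ m → a₂ (m + L) ≡ a₂ m mod 2L × a₃ (m + L) ≡ a₃ m mod 2L
  a₂a₃-periodic zero    = a₂L≡1 , a₃L≡1
  a₂a₃-periodic (suc m) with p₂ , p₃ ← a₂a₃-periodic m =
      stepwise (a₂-step (m + L)) (step₂-cong (z-shift m) p₀ p₃) (a₂-step m)
    , stepwise (a₃-step (m + L)) (step₃-cong (z-shift m) p₀ p₃) (a₃-step m)
    where p₀ = a₀-periodic-suc m p₂ p₃

  a₀-periodic : ∀ m → a₀ (m + L) ≡ a₀ m mod 2L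
  a₀-periodic zero    = a₀L≡1
  a₀-periodic (suc m) = a₀-periodic-suc m (proj₁ (a₂a₃-periodic m)) (proj₂ (a₂a₃-periodic m))

  a₁-periodic : ∀ m → a₁ (m + L) ≡ a₁ m mod 2L
  a₁-periodic zero    = a₁L≡1
  a₁-periodic (suc m) =
    stepwise (a₁-step (m + L)) (step₁-cong (z-shift m) (a₀-periodic (suc m)) (proj₂ (a₂a₃-periodic m))) (a₁-step m)

  β-periodic : ∀ n → β (n + L * 4) ≡ β n mod 2L
  β-periodic n = subst (λ n → β (n + L * 4) ≡ β n mod 2L) (sym (m≡m%n+[m/n]*n n 4))
    (stepwise (cong β (regroup (n % 4) (n / 4) L)) (by-residue (n % 4) (n / 4) (m%n<n n 4)) refl)
    where
    regroup : ∀ r m l → r + m * 4 + l * 4 ≡ r + (m + l) * 4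
    regroup = solve-∀
    by-residue : ∀ r m → r < 4 → β (r + (m + L) * 4) ≡ β (r + m * 4) mod 2L
    by-residue 0 m _ = stepwise (β-4m (m + L)) (a₀-periodic m) (β-4m m)
    by-residue 1 m _ = stepwise (β-4m+1 (m + L)) (a₁-periodic m) (β-4m+1 m)
    by-residue 2 m _ = stepwise (β-4m+2 (m + L)) (proj₁ (a₂a₃-periodic m)) (β-4m+2 m)
    by-residue 3 m _ = stepwise (β-4m+3 (m + L)) (proj₂ (a₂a₃-periodic m)) (β-4m+3 m)
    by-residue (suc (suc (suc (suc _)))) m (s≤s (s≤s (s≤s (s≤s ()))))

a₂[1+ℓ]%4L : ∀ ℓ Y → a₀ (suc ℓ) ≡ 1 + Y * (suc ℓ * 4) → a₂ (suc ℓ) % (suc ℓ * 4) ≡ 1 + 2 * suc ℓ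
a₂[1+ℓ]%4L ℓ Y a₀≡ = begin
  a₂ (suc ℓ) % (suc ℓ * 4)
    ≡⟨ cong (λ a → ((3 + ℓ * 2) * a + 2 * ((1 + ℓ) * 2 * a₃ ℓ)) % (suc ℓ * 4)) a₀≡ ⟩
  ((3 + ℓ * 2) * (1 + Y * (suc ℓ * 4)) + 2 * ((1 + ℓ) * 2 * a₃ ℓ)) % (suc ℓ * 4)
    ≡⟨ cong (_% (suc ℓ * 4)) (expand ℓ Y (a₃ ℓ)) ⟩
  (1 + 2 * suc ℓ + ((3 + ℓ * 2) * Y + a₃ ℓ) * (suc ℓ * 4)) % (suc ℓ * 4)
    ≡⟨ [m+kn]%n≡m%n (1 + 2 * suc ℓ) ((3 + ℓ * 2) * Y + a₃ ℓ) (suc ℓ * 4) ⟩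
  (1 + 2 * suc ℓ) % (suc ℓ * 4)
    ≡⟨ m<n⇒m%n≡m (subst (2 + 2 * suc ℓ ≤_) (split ℓ) (m≤m+n (2 + 2 * suc ℓ) (2 * ℓ))) ⟩
  1 + 2 * suc ℓ ∎
  where
  open ≡-Reasoning
  expand : ∀ l y q → (3 + l * 2) * (1 + y * (suc l * 4)) + 2 * ((1 + l) * 2 * q)
                   ≡ 1 + 2 * suc l + ((3 + l * 2) * y + q) * (suc l * 4)
  expand = solve-∀
  split : ∀ l → 2 + 2 * suc l + 2 * l ≡ suc l * 4
  split = solve-∀

2^n≡1+ℓ : ∀ n → ∃ λ ℓ → 2 ^ n ≡ suc ℓ
2^n≡1+ℓ n = pred (2 ^ n) , sym (suc-pred (2 ^ n) {{m^n≢0 2 n}})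

module _ (i : ℕ) where

  private
    instance
      2^[3+i]≢0 : NonZero (2 ^ (3 + i))
      2^[3+i]≢0 = m^n≢0 2 (3 + i)
      2^[4+i]≢0 : NonZero (2 ^ (4 + i))
      2^[4+i]≢0 = m^n≢0 2 (4 + i)

    2^[4+i]≡L*4 : ∀ {ℓ} → 2 ^ (2 + i) ≡ suc ℓ → 2 ^ (4 + i) ≡ suc ℓ * 4
    2^[4+i]≡L*4 2^[2+i]≡1+ℓ = trans (quadruple (2 ^ i)) (cong (_* 4) 2^[2+i]≡1+ℓ)
      where
      quadruple : ∀ x → 2 * (2 * (2 * (2 * x))) ≡ 2 * (2 * x) * 4
      quadruple = solve-∀

    a₀[1+ℓ]≡1+Y*4L : ∀ {ℓ} → 2 ^ (2 + i) ≡ suc ℓ → ∃ λ Y → a₀ (suc ℓ) ≡ 1 + Y * (suc ℓ * 4)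
    a₀[1+ℓ]≡1+Y*4L {ℓ} 2^[2+i]≡1+ℓ with Y , a₀≡ ← a₀[2^[2+i]]≡1+2^[4+i]*Y i = Y , (begin
      a₀ (suc ℓ)            ≡⟨ cong a₀ 2^[2+i]≡1+ℓ ⟨
      a₀ (2 ^ (2 + i))      ≡⟨ a₀≡ ⟩
      1 + 2 ^ (4 + i) * Y   ≡⟨ cong (1 +_) (trans (*-comm (2 ^ (4 + i)) Y) (cong (Y *_) (2^[4+i]≡L*4 2^[2+i]≡1+ℓ))) ⟩
      1 + Y * (suc ℓ * 4)   ∎)
      where open ≡-Reasoning

    β-period-via : ∀ ℓ → 2 ^ (2 + i) ≡ suc ℓ → ∀ n → β (n + 2 ^ (4 + i)) % 2 ^ (3 + i) ≡ β n % 2 ^ (3 + i)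
    β-period-via ℓ 2^[2+i]≡1+ℓ n = begin
      β (n + 2 ^ (4 + i)) % 2 ^ (3 + i)   ≡⟨ cong (λ N → β (n + N) % 2 ^ (3 + i)) (2^[4+i]≡L*4 2^[2+i]≡1+ℓ) ⟩
      β (n + suc ℓ * 4) % 2 ^ (3 + i)     ≡⟨ %-congʳ 2^[3+i]≡2L ⟩
      β (n + suc ℓ * 4) % (2 * suc ℓ)     ≡⟨ mod-elim (Periodicity.β-periodic ℓ a₀L≡1 n) ⟩
      β n % (2 * suc ℓ)                   ≡⟨ %-congʳ 2^[3+i]≡2L ⟨
      β n % 2 ^ (3 + i)                   ∎
      where
      open ≡-Reasoning
      2^[3+i]≡2L : 2 ^ (3 + i) ≡ 2 * suc ℓ
      2^[3+i]≡2L = cong (2 *_) 2^[2+i]≡1+ℓ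
      a₀L≡1 : a₀ (suc ℓ) ≡ 1 mod (2 * suc ℓ)
      a₀L≡1 with Y , a₀≡ ← a₀[1+ℓ]≡1+Y*4L 2^[2+i]≡1+ℓ =
        trans-mod (≡⇒≡-mod (trans a₀≡ (cong (1 +_) (regroup Y ℓ)))) (x+k*M≡x-mod 1 (2 * Y))
        where
        regroup : ∀ y l → y * (suc l * 4) ≡ 2 * y * (2 * suc l)
        regroup = solve-∀

    a₂≢1-via : ∀ ℓ → 2 ^ (2 + i) ≡ suc ℓ → a₂ (2 ^ (2 + i)) % 2 ^ (4 + i) ≢ 1 % 2 ^ (4 + i)
    a₂≢1-via ℓ 2^[2+i]≡1+ℓ a₂≡1 with Y , a₀≡ ← a₀[1+ℓ]≡1+Y*4L 2^[2+i]≡1+ℓ = 2L≢0 (suc-injective (begin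
      1 + 2 * suc ℓ                 ≡⟨ a₂[1+ℓ]%4L ℓ Y a₀≡ ⟨
      a₂ (suc ℓ) % (suc ℓ * 4)      ≡⟨ %-congʳ (2^[4+i]≡L*4 2^[2+i]≡1+ℓ) ⟨
      a₂ (suc ℓ) % 2 ^ (4 + i)      ≡⟨ cong (λ m → a₂ m % 2 ^ (4 + i)) 2^[2+i]≡1+ℓ ⟨
      a₂ (2 ^ (2 + i)) % 2 ^ (4 + i) ≡⟨ a₂≡1 ⟩
      1 % 2 ^ (4 + i)               ≡⟨ m<n⇒m%n≡m (*-monoʳ-≤ 2 (m^n>0 2 (3 + i))) ⟩
      1                             ∎))
      where
      open ≡-Reasoning
      2L≢0 : 2 * suc ℓ ≢ 0
      2L≢0 ()

  β-period : ∀ n → β (n + 2 ^ (4 + i)) % 2 ^ (3 + i) ≡ β n % 2 ^ (3 + i)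
  β-period = β-period-via (proj₁ (2^n≡1+ℓ (2 + i))) (proj₂ (2^n≡1+ℓ (2 + i)))

  a₂[2^[2+i]]≢1 : a₂ (2 ^ (2 + i)) % 2 ^ (4 + i) ≢ 1 % 2 ^ (4 + i)
  a₂[2^[2+i]]≢1 = a₂≢1-via (proj₁ (2^n≡1+ℓ (2 + i))) (proj₂ (2^n≡1+ℓ (2 + i)))
β-not-period : ∀ N m .{{_ : NonZero N}} → N ≡ m * 4 → a₂ m % N ≢ 1 % N → β (2 + N) % N ≢ β 2 % N
β-not-period N m refl a₂≢1 β≡ = a₂≢1 (begin
  a₂ m % N             ≡⟨ cong (_% N) (β-4m+2 m) ⟨
  β (2 + m * 4) % N    ≡⟨ β≡ ⟩
  β 2 % N              ≡⟨ cong (_% N) (β-4m+2 0) ⟩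
  1 % N                ∎)
  where open ≡-Reasoning


β[2+2^s]≢β[2] : ∀ i →
  _%_ (β (2 + 2 ^ (3 + i))) (2 ^ (3 + i)) {{m^n≢0 2 (3 + i)}} ≢ _%_ (β 2) (2 ^ (3 + i)) {{m^n≢0 2 (3 + i)}}
β[2+2^s]≢β[2] zero    = β-not-period (2 ^ (3 + zero)) 2 {{m^n≢0 2 (3 + zero)}} refl (λ ())
β[2+2^s]≢β[2] (suc i) =
  β-not-period (2 ^ (3 + suc i)) (2 ^ (2 + i)) {{m^n≢0 2 (3 + suc i)}} (quadruple (2 ^ i)) (a₂[2^[2+i]]≢1 i)
  where
  quadruple : ∀ x → 2 * (2 * (2 * (2 * x))) ≡ 2 * (2 * x) * 4
  quadruple = solve-∀

-- Periods

Periodic : (ℕ → ℕ) → ℕ → Set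
Periodic f d = ∀ n → f (n + d) ≡ f n

module _ {f : ℕ → ℕ} where

  periodic-* : ∀ {d} → Periodic f d → ∀ k → Periodic f (k * d)
  periodic-* p zero    n = cong f (+-identityʳ n)
  periodic-* {d} p (suc k) n = trans (cong f (sym (+-assoc n d (k * d)))) (trans (periodic-* p k (n + d)) (p n))

  periodic-∸ : ∀ {a b c} → Periodic f a → Periodic f b → c + b ≡ a → Periodic f c
  periodic-∸ {a} {b} {c} pa pb c+b≡a n = trans (sym (pb (n + c))) (trans (cong f (trans (+-assoc n c b) (cong (n +_) c+b≡a))) (pa n))

  periodic-gcd : ∀ {a b} → Periodic f a → Periodic f b → Periodic f (gcd a b)
  periodic-gcd {a} {b} pa pb with Bézout.identity (gcd-GCD a b)
  ... | Bézout.Identity.+- x y eq = periodic-∸ (periodic-* pa x) (periodic-* pb y) eq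
  ... | Bézout.Identity.-+ x y eq = periodic-∸ (periodic-* pb y) (periodic-* pa x) eq

  2^[1+s]≤period : ∀ s → Periodic f (2 ^ suc s) → ¬ Periodic f (2 ^ s) → ∀ d → IsPeriod f d → 2 ^ suc s ≤ d
  2^[1+s]≤period s p ¬p d (d>0 , pd) with 2 ^ suc s ≤? d
  ... | yes 2^[1+s]≤d = 2^[1+s]≤d
  ... | no  2^[1+s]≰d with e , g≡2^e ← ∣2^k⇒≡2^e (suc s) (gcd[m,n]∣n d (2 ^ suc s)) =
    ⊥-elim (¬p (subst (Periodic f) 2^[s∸e]*g≡2^s (periodic-* pg (2 ^ (s ∸ e)))))
    where
    pg : Periodic f (gcd d (2 ^ suc s))
    pg = periodic-gcd pd p
    g≤d : gcd d (2 ^ suc s) ≤ d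
    g≤d = ∣⇒≤ {{>-nonZero d>0}} (gcd[m,n]∣m d (2 ^ suc s))
    e≤s : e ≤ s
    e≤s with e ≤? s
    ... | yes e≤s = e≤s
    ... | no  e≰s = ⊥-elim (2^[1+s]≰d (≤-trans (^-monoʳ-≤ 2 (≰⇒> e≰s)) (subst (_≤ d) g≡2^e g≤d)))
    2^[s∸e]*g≡2^s : 2 ^ (s ∸ e) * gcd d (2 ^ suc s) ≡ 2 ^ s
    2^[s∸e]*g≡2^s = trans (cong (2 ^ (s ∸ e) *_) g≡2^e)
      (trans (sym (^-distribˡ-+-* 2 (s ∸ e) e)) (cong (2 ^_) (m∸n+n≡m e≤s)))

theorem6p6 : (s : ℕ) → 3 ≤ s →
    IsSmallestPeriod (λ n → _%_ (β n) (2 ^ s) {{m^n≢0 2 s}}) (2 ^ suc s)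
theorem6p6 s 3≤s with i , refl ← m≤n⇒∃[o]m+o≡n 3≤s =
  (m^n>0 2 (4 + i) , β-period i) , 2^[1+s]≤period (3 + i) (β-period i) (λ p → β[2+2^s]≢β[2] i (p 2))
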